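{- Let $F$ be a $2$-regular digraph of order $2m$. There exists an admissible $F$-decomposition of $J^*_{2m}$ with external pattern $\mathcal{X}$ in each of the following cases: (1) $F=[2s]$ with $s\ge4$; (2) $F=[2s,2]$ with $s\ge4$; (3) $F=[2s,2^2]$ with $s\ge4$; (4) $F=[2s,4]$ with $s\ge5$.
   Context: A $2$-regular digraph $[m_1^{\alpha_1},\ldots,m_t^{\alpha_t}]$ is a vertex-disjoint union of directed cycles, $\alpha_i$ of length $m_i$ (each length $\ge2$; a directed $2$-cycle on $\{u,v\}$ has arcs $uv,vu$); its order is its number of vertices. For a graph $G$, $G^*$ replaces each edge $\{u,v\}$ by arcs $uv,vu$. $J_{2m}$ has vertex set $\{x_i,y_i: 0\le i\le m+1\}$ and edges $\{x_i,y_i\}$ ($1\le i\le m$) and $\{x_i,x_{i+1}\},\{y_i,y_{i+1}\},\{x_i,y_{i+1}\},\{y_i,x_{i+1}\},\{x_i,x_{i+2}\},\{y_i,y_{i+2}\},\{x_i,y_{i+2}\},\{y_i,x_{i+2}\}$ ($0\le i\le m-1$). An admissible $2$-regular subdigraph of $J^*_{2m}$ is a $2$-regular subdigraph of order $2m$ containing exactly one vertex of each of $\{x_0,x_m\},\{x_1,x_{m+1}\},\{y_0,y_m\},\{y_1,y_{m+1}\}$; its external pattern is $V(F)\cap\{x_0,x_1,y_0,y_1\}$. An admissible $F$-decomposition of $J^*_{2m}$ with external pattern $(X_1,\ldots,X_9)$ is a list $(F_1,\ldots,F_9)$ of pairwise arc-disjoint admissible $2$-regular subdigraphs, each isomorphic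 to $F$, whose arc sets partition $A(J^*_{2m})$, with $F_i$ having external pattern $X_i$. $\mathcal{X}=(\{y_1\},\{x_0,x_1,y_1\},\{x_1,y_0,y_1\},\{x_0,x_1,y_0,y_1\},\{y_1\},\{x_0,x_1,y_0\},\{x_1,y_1\},\{x_1\},\{x_0,x_1,y_0,y_1\})$. -}

module Defs where

open import Data.Nat using (ℕ; zero; suc; _≤_; _*_)
open import Data.List using (List; []; _∷_; _++_; map; concat; concatMap; zip; length)
open import Data.List.Membership.Propositional using (_∈_)
open import Data.List.Relation.Unary.Unique.Propositional using (Unique)
open import Data.Product using (Σ; ∃; _×_; _,_)
open import Data.Sum using (_⊎_)
open import Data.Fin using (Fin)
open import Data.Vec using (Vec; lookup) renaming (_∷_ to _∷ᵥ_; [] to []ᵥ)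
open import Relation.Nullary using (¬_)
open import Relation.Binary.PropositionalEquality using (_≡_)
open import Function.Bundles using (_⇔_)

-- Vertices of J_{2m}: x_i = (sx , i), y_i = (sy , i).  Only indices
-- 0 ≤ i ≤ m+1 ever occur in edges, so we use ℕ for the index.

data Side : Set where
  sx sy : Side

V : Set
V = Side × ℕ

xv yv : ℕ → V
xv i = sx , i
yv i = sy , i

-- Edges of J_{2m} (each undirected edge listed in one orientation).
data Edge (m : ℕ) : V → V → Set where
  rung  : ∀ {i} → 1 ≤ i → i ≤ m → Edge m (xv i) (yv i)
  step1 : ∀ {a b i} → suc i ≤ m → Edge m (a , i) (b , suc i)
  step2 : ∀ {a b i} → suc i ≤ m → Edge m (a , i) (b , suc (suc i))

Arc : ℕ → V → V → Set
Arc m u v = Edge m u v ⊎ Edge m v u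

-- A copy of the 2-regular digraph [L] = [m_1,...,m_t] inside the vertex
-- set: a list of directed cycles, the j-th given by its cyclic vertex
-- sequence of length m_j, all vertices pairwise distinct.

cycleArcs : List V → List (V × V)
cycleArcs []       = []
cycleArcs (v ∷ vs) = zip (v ∷ vs) (vs ++ (v ∷ []))

record Copy (L : List ℕ) : Set where
  field
    cycles   : List (List V)
    shape    : map length cycles ≡ L
    distinct : Unique (concat cycles)
open Copy public

vertsOf : ∀ {L} → Copy L → List V
vertsOf C = concat (cycles C)

arcsOf : ∀ {L} → Copy L → List (V × V)
arcsOf C = concatMap cycleArcs (cycles C)

IsSubJ : ∀ {L} → ℕ → Copy L → Set
IsSubJ m C = ∀ u v → (u , v) ∈ arcsOf C → Arc m u v

ExactlyOne : ∀ {L} → Copy L → V → V → Set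
ExactlyOne C u v = (u ∈ vertsOf C ⊎ v ∈ vertsOf C) × ¬ (u ∈ vertsOf C × v ∈ vertsOf C)

-- admissible (order 2m is imposed separately via sum L ≡ 2 * m)
Admissible : ∀ {L} → ℕ → Copy L → Set
Admissible m C =
  IsSubJ m C ×
  ExactlyOne C (xv 0) (xv m) × ExactlyOne C (xv 1) (xv (suc m)) ×
  ExactlyOne C (yv 0) (yv m) × ExactlyOne C (yv 1) (yv (suc m))

extVerts : List V
extVerts = xv 0 ∷ xv 1 ∷ yv 0 ∷ yv 1 ∷ []

HasPattern : ∀ {L} → Copy L → List V → Set
HasPattern C P = ∀ w → w ∈ extVerts → (w ∈ vertsOf C ⇔ w ∈ P)

AdmDecomp : ℕ → (L : List ℕ) → Vec (List V) 9 → Set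
AdmDecomp m L P =
  Σ (Fin 9 → Copy L) λ F →
    (∀ k → Admissible m (F k)) ×
    (∀ k → HasPattern (F k) (lookup P k)) ×
    (∀ k k' a → a ∈ arcsOf (F k) → a ∈ arcsOf (F k') → k ≡ k') ×
    (∀ u v → Arc m u v → ∃ λ k → (u , v) ∈ arcsOf (F k))

𝒳 : Vec (List V) 9
𝒳 = (yv 1 ∷ [])
  ∷ᵥ (xv 0 ∷ xv 1 ∷ yv 1 ∷ [])
  ∷ᵥ (xv 1 ∷ yv 0 ∷ yv 1 ∷ [])
  ∷ᵥ (xv 0 ∷ xv 1 ∷ yv 0 ∷ yv 1 ∷ [])
  ∷ᵥ (yv 1 ∷ [])
  ∷ᵥ (xv 0 ∷ xv 1 ∷ yv 0 ∷ [])
  ∷ᵥ (xv 1 ∷ yv 1 ∷ [])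
  ∷ᵥ (xv 1 ∷ [])
  ∷ᵥ (xv 0 ∷ xv 1 ∷ yv 0 ∷ yv 1 ∷ [])
  ∷ᵥ []ᵥ

{-# OPTIONS --safe #-}
module Submission where

-- For a few small orders the nine copies are listed explicitly and every condition of an
-- admissible decomposition is checked by running a decision procedure. Larger orders come
-- from inserting four new columns between columns 3 and 4: columns i ≥ 4 move to i + 4,
-- every arc that does not cross between columns ≤ 3 and ≥ 4 is shifted, and each of the 24
-- crossing arcs is replaced by a fixed path through the new columns 4–7. These paths and the
-- shifted arcs partition the arcs of J*_{2(m+4)}, which is a finite check near the new columns.
-- If in every copy all crossing arcs lie on the long cycle and their paths pass through eight
-- distinct new vertices, the long cycle grows by 8 while the short cycles and the external
-- pattern stay as they are; as each replacement path crosses the cut only in the original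
-- arc, the same holds after the insertion. Insertion needs m ≥ 6, so each family starts from
-- four consecutive insertable decompositions plus one or two smaller ones.

open import Defs
open import Data.Bool using (if_then_else_)
open import Data.Empty using (⊥; ⊥-elim)
open import Data.Fin as Fin using (Fin)
open import Data.Fin.Properties using (all?; any?)
open import Data.List using (List; []; _∷_; _++_; map; concat; concatMap; upTo; length; zip)
open import Data.List.Properties as List using ()
open import Data.List.Membership.Propositional using (_∈_; _∉_; find; lose)
open import Data.List.Membership.Propositional.Properties
  using (∈-++⁺ˡ; ∈-++⁺ʳ; ∈-++⁻; ∈-map⁺; ∈-map⁻; ∈-concatMap⁺; ∈-concatMap⁻; ∈-upTo⁺; ∈-upTo⁻)
open import Data.List.Relation.Binary.Disjoint.Propositional using (Disjoint)
open import Data.List.Relation.Binary.Permutation.Propositional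
  using (_↭_; ↭-refl; ↭-trans; ↭-sym; prep; ↭⇒↭ₛ; module PermutationReasoning)
open import Data.List.Relation.Binary.Permutation.Propositional.Properties
  using (++⁺; ++⁺ˡ; shifts; ∈-resp-↭; ↭-length)
import Data.List.Relation.Binary.Permutation.Setoid.Properties as PermSetoid
open import Data.List.Relation.Unary.All as All using (All; []; _∷_)
open import Data.List.Relation.Unary.All.Properties using (map⁺; concat⁺)
open import Data.List.Relation.Unary.Any as Any using (Any; here; there)
open import Data.List.Relation.Unary.Unique.Propositional using (Unique)
import Data.List.Relation.Unary.Unique.Propositional.Properties as Unique
open import Data.Nat as ℕ using (ℕ; zero; suc; _+_; _*_; _≤_; _<_; z≤n; s≤s)
open import Data.Nat.ListAction using (sum)
open import Data.Nat.Properties as ℕ using ()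
open import Data.Product using (Σ; ∃; _×_; _,_; proj₁; proj₂; swap; uncurry)
open import Data.Product.Properties as Product using ()
open import Data.Sum as Sum using (_⊎_; inj₁; inj₂; [_,_])
open import Data.Vec using (Vec; lookup) renaming (_∷_ to _∷ᵥ_; [] to []ᵥ)
open import Function using (id; _∘_)
open import Function.Bundles using (_⇔_; mk⇔; Equivalence)
import Function.Properties.Equivalence as ⇔
open import Relation.Binary.Definitions using (DecidableEquality)
open import Relation.Binary.PropositionalEquality
  using (_≡_; refl; sym; trans; cong; cong₂; subst; subst₂; setoid; module ≡-Reasoning)
open import Relation.Nullary using (Dec; does; yes; no; ¬_; ¬?)
open import Relation.Nullary.Decidable
  using (True; toWitness; map′; _×-dec_; _⊎-dec_; _→-dec_; toSum; from-yes)

pathArcs : ∀ {A : Set} → List A → List (A × A)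
pathArcs (u ∷ v ∷ p) = (u , v) ∷ pathArcs (v ∷ p)
pathArcs _ = []

pathArcs-++ : ∀ {A : Set} (xs : List A) y ys →
  pathArcs (xs ++ y ∷ ys) ≡ pathArcs (xs ++ y ∷ []) ++ pathArcs (y ∷ ys)
pathArcs-++ [] y ys = refl
pathArcs-++ (x ∷ []) y ys = refl
pathArcs-++ (x ∷ x′ ∷ xs) y ys = cong ((x , x′) ∷_) (pathArcs-++ (x′ ∷ xs) y ys)

map-proj₁-pathArcs : ∀ {A : Set} (xs : List A) y → map proj₁ (pathArcs (xs ++ y ∷ [])) ≡ xs
map-proj₁-pathArcs [] y = refl
map-proj₁-pathArcs (x ∷ []) y = refl
map-proj₁-pathArcs (x ∷ x′ ∷ xs) y = cong (x ∷_) (map-proj₁-pathArcs (x′ ∷ xs) y)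

concatMap-concatMap : ∀ {A B C : Set} (f : B → List C) (g : A → List B) xs →
  concatMap f (concatMap g xs) ≡ concatMap (concatMap f ∘ g) xs
concatMap-concatMap f g [] = refl
concatMap-concatMap f g (x ∷ xs) =
  trans (List.concatMap-++ f (g x) (concatMap g xs))
        (cong (concatMap f (g x) ++_) (concatMap-concatMap f g xs))

concatMap-∷-↭ : ∀ {A B : Set} (f : A → B) (g : A → List B) xs →
  concatMap (λ x → f x ∷ g x) xs ↭ map f xs ++ concatMap g xs
concatMap-∷-↭ f g [] = ↭-refl
concatMap-∷-↭ f g (x ∷ xs) =
  prep (f x) (↭-trans (++⁺ˡ (g x) (concatMap-∷-↭ f g xs)) (shifts (g x) (map f xs)))

cycleArcs-pathArcs : ∀ v vs → cycleArcs (v ∷ vs) ≡ pathArcs (v ∷ vs ++ v ∷ [])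
cycleArcs-pathArcs v vs = zip-snoc v vs
  where
  zip-snoc : ∀ x xs → zip (x ∷ xs) (xs ++ v ∷ []) ≡ pathArcs (x ∷ xs ++ v ∷ [])
  zip-snoc x [] = refl
  zip-snoc x (x′ ∷ xs) = cong ((x , x′) ∷_) (zip-snoc x′ xs)

map-proj₁-cycleArcs : ∀ c → map proj₁ (cycleArcs c) ≡ c
map-proj₁-cycleArcs [] = refl
map-proj₁-cycleArcs (v ∷ vs) =
  trans (cong (map proj₁) (cycleArcs-pathArcs v vs)) (map-proj₁-pathArcs (v ∷ vs) v)

-- The arcs of J*_{2m}

_≟ˢ_ : DecidableEquality Side
sx ≟ˢ sx = yes refl
sx ≟ˢ sy = no λ ()
sy ≟ˢ sx = no λ ()
sy ≟ˢ sy = yes refl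

_≟ᵛ_ : DecidableEquality V
_≟ᵛ_ = Product.≡-dec _≟ˢ_ ℕ._≟_

_≟ᵃ_ : DecidableEquality (V × V)
_≟ᵃ_ = Product.≡-dec _≟ᵛ_ _≟ᵛ_

open import Data.List.Membership.DecPropositional _≟ᵛ_ using (_∈?_)
open import Data.List.Membership.DecPropositional _≟ᵃ_ using () renaming (_∈?_ to _∈ᵃ?_)
open import Data.List.Relation.Unary.Unique.DecPropositional _≟ᵛ_ using (unique?)

edgesFrom : ℕ → List (V × V)
edgesFrom i = (xv (suc i) , yv (suc i))
  ∷ (xv i , xv (suc i)) ∷ (xv i , yv (suc i)) ∷ (yv i , xv (suc i)) ∷ (yv i , yv (suc i))
  ∷ (xv i , xv (2 + i)) ∷ (xv i , yv (2 + i)) ∷ (yv i , xv (2 + i)) ∷ (yv i , yv (2 + i)) ∷ []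

∈-edgesFrom⁻ : ∀ {m i u v} → i < m → (u , v) ∈ edgesFrom i → Edge m u v
∈-edgesFrom⁻ i<m (here refl) = rung (s≤s z≤n) i<m
∈-edgesFrom⁻ i<m (there (here refl)) = step1 i<m
∈-edgesFrom⁻ i<m (there (there (here refl))) = step1 i<m
∈-edgesFrom⁻ i<m (there (there (there (here refl)))) = step1 i<m
∈-edgesFrom⁻ i<m (there (there (there (there (here refl))))) = step1 i<m
∈-edgesFrom⁻ i<m (there (there (there (there (there (here refl)))))) = step2 i<m
∈-edgesFrom⁻ i<m (there (there (there (there (there (there (here refl))))))) = step2 i<m
∈-edgesFrom⁻ i<m (there (there (there (there (there (there (there (here refl)))))))) = step2 i<m
∈-edgesFrom⁻ i<m (there (there (there (there (there (there (there (there (here refl))))))))) = step2 i<m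

∈-edgesFrom⁺ : ∀ {m u v} → Edge m u v → ∃ λ i → i < m × (u , v) ∈ edgesFrom i
∈-edgesFrom⁺ (rung {suc i} _ i<m) = i , i<m , here refl
∈-edgesFrom⁺ (step1 {sx} {sx} i<m) = _ , i<m , there (here refl)
∈-edgesFrom⁺ (step1 {sx} {sy} i<m) = _ , i<m , there (there (here refl))
∈-edgesFrom⁺ (step1 {sy} {sx} i<m) = _ , i<m , there (there (there (here refl)))
∈-edgesFrom⁺ (step1 {sy} {sy} i<m) = _ , i<m , there (there (there (there (here refl))))
∈-edgesFrom⁺ (step2 {sx} {sx} i<m) = _ , i<m , there (there (there (there (there (here refl)))))
∈-edgesFrom⁺ (step2 {sx} {sy} i<m) = _ , i<m , there (there (there (there (there (there (here refl))))))
∈-edgesFrom⁺ (step2 {sy} {sx} i<m) = _ , i<m , there (there (there (there (there (there (there (here refl)))))))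
∈-edgesFrom⁺ (step2 {sy} {sy} i<m) = _ , i<m , there (there (there (there (there (there (there (there (here refl))))))))

jEdges : ℕ → List (V × V)
jEdges m = concatMap edgesFrom (upTo m)

jArcs : ℕ → List (V × V)
jArcs m = jEdges m ++ map swap (jEdges m)

∈-jEdges⁻ : ∀ {m u v} → (u , v) ∈ jEdges m → Edge m u v
∈-jEdges⁻ e∈ with find (∈-concatMap⁻ edgesFrom e∈)
... | _ , i∈ , e∈i = ∈-edgesFrom⁻ (∈-upTo⁻ i∈) e∈i

∈-jEdges⁺ : ∀ {m u v} → Edge m u v → (u , v) ∈ jEdges m
∈-jEdges⁺ e with ∈-edgesFrom⁺ e
... | i , i<m , e∈i = ∈-concatMap⁺ edgesFrom (Any.map (λ { refl → e∈i }) (∈-upTo⁺ i<m))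

∈-jArcs⁻ : ∀ {m u v} → (u , v) ∈ jArcs m → Arc m u v
∈-jArcs⁻ {m} a∈ with ∈-++⁻ (jEdges m) a∈
... | inj₁ e∈ = inj₁ (∈-jEdges⁻ e∈)
... | inj₂ e∈ with ∈-map⁻ swap e∈
...   | (_ , _) , e∈′ , refl = inj₂ (∈-jEdges⁻ e∈′)

∈-jArcs⁺ : ∀ {m u v} → Arc m u v → (u , v) ∈ jArcs m
∈-jArcs⁺ (inj₁ e) = ∈-++⁺ˡ (∈-jEdges⁺ e)
∈-jArcs⁺ {m} (inj₂ e) = ∈-++⁺ʳ (jEdges m) (∈-map⁺ swap (∈-jEdges⁺ e))

arc? : ∀ m u v → Dec (Arc m u v)
arc? m u v = map′ ∈-jArcs⁻ ∈-jArcs⁺ ((u , v) ∈ᵃ? jArcs m)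

Edge-mono : ∀ {m m′ u v} → m ≤ m′ → Edge m u v → Edge m′ u v
Edge-mono m≤m′ (rung 1≤i i≤m) = rung 1≤i (ℕ.≤-trans i≤m m≤m′)
Edge-mono m≤m′ (step1 i<m) = step1 (ℕ.≤-trans i<m m≤m′)
Edge-mono m≤m′ (step2 i<m) = step2 (ℕ.≤-trans i<m m≤m′)

Edge-restrict : ∀ {m m′ s i t j} → j ≤ m′ → Edge m (s , i) (t , j) → Edge m′ (s , i) (t , j)
Edge-restrict j≤m′ (rung 1≤i _) = rung 1≤i j≤m′
Edge-restrict j≤m′ (step1 _) = step1 j≤m′
Edge-restrict j≤m′ (step2 _) = step2 (ℕ.≤-trans (ℕ.n≤1+n _) j≤m′)

Edge-near : ∀ {m s i t j} → Edge m (s , i) (t , j) → i ≤ j × j ≤ 2 + i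
Edge-near {i = i} (rung _ _) = ℕ.≤-refl , ℕ.m≤n+m i 2
Edge-near {i = i} (step1 _) = ℕ.n≤1+n i , s≤s (ℕ.n≤1+n i)
Edge-near {i = i} (step2 _) = ℕ.m≤n+m i 2 , ℕ.≤-refl

Edge-translate : ∀ k {m s i t j} → Edge m (s , i) (t , j) → Edge (k + m) (s , k + i) (t , k + j)
Edge-translate zero e = e
Edge-translate (suc k) e = Edge-suc (Edge-translate k e)
  where
  Edge-suc : ∀ {m s i t j} → Edge m (s , i) (t , j) → Edge (suc m) (s , suc i) (t , suc j)
  Edge-suc (rung _ i≤m) = rung (s≤s z≤n) (s≤s i≤m)
  Edge-suc (step1 i<m) = step1 (s≤s i<m)
  Edge-suc (step2 i<m) = step2 (s≤s i<m)

Edge-untranslate : ∀ k {m s i t j} → 1 ≤ i → Edge (k + m) (s , k + i) (t , k + j) → Edge m (s , i) (t , j)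
Edge-untranslate zero _ e = e
Edge-untranslate (suc k) {i = i} 1≤i e =
  Edge-untranslate k 1≤i (Edge-pred (ℕ.≤-trans 1≤i (ℕ.m≤n+m i k)) e)
  where
  Edge-pred : ∀ {m s i t j} → 1 ≤ i → Edge (suc m) (s , suc i) (t , suc j) → Edge m (s , i) (t , j)
  Edge-pred 1≤i (rung _ i<m) = rung 1≤i (ℕ.s≤s⁻¹ i<m)
  Edge-pred _ (step1 i<m) = step1 (ℕ.s≤s⁻¹ i<m)
  Edge-pred _ (step2 i<m) = step2 (ℕ.s≤s⁻¹ i<m)

Arc-mono : ∀ {m m′ u v} → m ≤ m′ → Arc m u v → Arc m′ u v
Arc-mono m≤m′ = Sum.map (Edge-mono m≤m′) (Edge-mono m≤m′)

Arc-restrict : ∀ {m m′ s i t j} → i ≤ m′ → j ≤ m′ → Arc m (s , i) (t , j) → Arc m′ (s , i) (t , j)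
Arc-restrict i≤m′ j≤m′ = Sum.map (Edge-restrict j≤m′) (Edge-restrict i≤m′)

Arc-near : ∀ {m s i t j} → Arc m (s , i) (t , j) → j ≤ 2 + i × i ≤ 2 + j
Arc-near {j = j} (inj₁ e) = let i≤j , j≤ = Edge-near e in j≤ , ℕ.≤-trans i≤j (ℕ.m≤n+m j 2)
Arc-near {i = i} (inj₂ e) = let j≤i , i≤ = Edge-near e in ℕ.≤-trans j≤i (ℕ.m≤n+m i 2) , i≤

Arc-translate : ∀ k {m s i t j} → Arc m (s , i) (t , j) → Arc (k + m) (s , k + i) (t , k + j)
Arc-translate k = Sum.map (Edge-translate k) (Edge-translate k)

Arc-untranslate : ∀ k {m s i t j} → 1 ≤ i → 1 ≤ j →
  Arc (k + m) (s , k + i) (t , k + j) → Arc m (s , i) (t , j)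
Arc-untranslate k 1≤i 1≤j = Sum.map (Edge-untranslate k 1≤i) (Edge-untranslate k 1≤j)

near-bounded : ∀ {i j k} → i < k → j ≤ 2 + i → i ≤ 2 + k × j ≤ 2 + k
near-bounded {k = k} i<k j≤ =
  ℕ.≤-trans (ℕ.<⇒≤ i<k) (ℕ.m≤n+m k 2) , ℕ.≤-trans j≤ (ℕ.+-monoʳ-≤ 2 (ℕ.<⇒≤ i<k))

isSubJ? : ∀ m {L} (C : Copy L) → Dec (IsSubJ m C)
isSubJ? m C = map′ (λ arcs u v → All.lookup arcs) (λ sub → All.tabulate (sub _ _))
  (All.all? (λ (u , v) → arc? m u v) (arcsOf C))

exactlyOne? : ∀ {L} (C : Copy L) u v → Dec (ExactlyOne C u v)
exactlyOne? C u v = (u ∈? vertsOf C ⊎-dec v ∈? vertsOf C) ×-dec ¬? (u ∈? vertsOf C ×-dec v ∈? vertsOf C)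

admissible? : ∀ m {L} (C : Copy L) → Dec (Admissible m C)
admissible? m C = isSubJ? m C
  ×-dec exactlyOne? C (xv 0) (xv m) ×-dec exactlyOne? C (xv 1) (xv (suc m))
  ×-dec exactlyOne? C (yv 0) (yv m) ×-dec exactlyOne? C (yv 1) (yv (suc m))

hasPattern? : ∀ {L} (C : Copy L) P → Dec (HasPattern C P)
hasPattern? C P = map′ (λ agree _ w∈ → uncurry mk⇔ (All.lookup agree w∈))
  (λ pat → All.tabulate λ w∈ → let open Equivalence (pat _ w∈) in to , from)
  (All.all? (λ w → (w ∈? vertsOf C →-dec w ∈? P) ×-dec (w ∈? P →-dec w ∈? vertsOf C)) extVerts)

ArcDisjoint : ∀ {n L} → (Fin n → Copy L) → Set
ArcDisjoint F = ∀ k k′ a → a ∈ arcsOf (F k) → a ∈ arcsOf (F k′) → k ≡ k′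

arcDisjoint? : ∀ {n L} (F : Fin n → Copy L) → Dec (ArcDisjoint F)
arcDisjoint? F = map′
  (λ sep k k′ a a∈ a∈′ → [ id , (λ a∉ → ⊥-elim (All.lookup a∉ a∈ a∈′)) ] (sep k k′))
  (λ disj k k′ → Sum.map₂ (λ k≢k′ → All.tabulate λ a∈ a∈′ → k≢k′ (disj k k′ _ a∈ a∈′))
                           (toSum (k Fin.≟ k′)))
  (all? λ k → all? λ k′ → k Fin.≟ k′ ⊎-dec All.all? (λ a → ¬? (a ∈ᵃ? arcsOf (F k′))) (arcsOf (F k)))

Covers : ∀ {n L} → ℕ → (Fin n → Copy L) → Set
Covers m F = ∀ u v → Arc m u v → ∃ λ k → (u , v) ∈ arcsOf (F k)

covers? : ∀ {n L} m (F : Fin n → Copy L) → Dec (Covers m F)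
covers? m F = map′
  (λ cov u v uv → All.lookup cov (∈-jArcs⁺ uv)) (λ cov → All.tabulate λ a∈ → cov _ _ (∈-jArcs⁻ a∈))
  (All.all? (λ a → any? λ k → a ∈ᵃ? arcsOf (F k)) (jArcs m))

IsAdmDecomp : ∀ {L} → ℕ → Vec (List V) 9 → (Fin 9 → Copy L) → Set
IsAdmDecomp m P F =
  (∀ k → Admissible m (F k)) × (∀ k → HasPattern (F k) (lookup P k)) × ArcDisjoint F × Covers m F

isAdmDecomp? : ∀ {L} m P (F : Fin 9 → Copy L) → Dec (IsAdmDecomp m P F)
isAdmDecomp? m P F = all? (λ k → admissible? m (F k)) ×-dec all? (λ k → hasPattern? (F k) (lookup P k))
  ×-dec arcDisjoint? F ×-dec covers? m F

IsCopy : List ℕ → List (List V) → Set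
IsCopy L cs = map length cs ≡ L × Unique (concat cs)

isCopy? : ∀ L cs → Dec (IsCopy L cs)
isCopy? L cs = List.≡-dec ℕ._≟_ (map length cs) L ×-dec unique? (concat cs)

toCopy : ∀ {L cs} → IsCopy L cs → Copy L
toCopy {cs = cs} (shape , distinct) = record { cycles = cs ; shape = shape ; distinct = distinct }

fromCycles : ∀ m L P (cs : Vec (List (List V)) 9)
  {copies : True (all? λ k → isCopy? L (lookup cs k))}
  {decomp : True (isAdmDecomp? m P λ k → toCopy (toWitness copies k))} → AdmDecomp m L P
fromCycles m L P cs {copies} {decomp} = (λ k → toCopy (toWitness copies k)) , toWitness decomp

-- Inserting four columns

-- Column i ≥ 4 moves to i + 4, so columns 4–7 of the larger graph hold the inserted vertices.
shiftCol : ℕ → ℕ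
shiftCol (suc (suc (suc (suc i)))) = 8 + i
shiftCol i = i

unshiftCol : ℕ → ℕ
unshiftCol (suc (suc (suc (suc (suc (suc (suc (suc i)))))))) = 4 + i
unshiftCol i = i

shift : V → V
shift (s , i) = s , shiftCol i

unshift : V → V
unshift (s , i) = s , unshiftCol i

unshift-shift : ∀ w → unshift (shift w) ≡ w
unshift-shift (s , 0) = refl
unshift-shift (s , 1) = refl
unshift-shift (s , 2) = refl
unshift-shift (s , 3) = refl
unshift-shift (s , suc (suc (suc (suc i)))) = refl

shift-injective : ∀ {u v} → shift u ≡ shift v → u ≡ v
shift-injective {u} {v} eq = trans (sym (unshift-shift u)) (trans (cong unshift eq) (unshift-shift v))

shiftCol-< : ∀ {i} → i < 4 → shiftCol i ≡ i
shiftCol-< {0} _ = refl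
shiftCol-< {1} _ = refl
shiftCol-< {2} _ = refl
shiftCol-< {3} _ = refl
shiftCol-< {suc (suc (suc (suc _)))} (s≤s (s≤s (s≤s (s≤s ()))))

shiftCol-≥ : ∀ {i} → 4 ≤ i → shiftCol i ≡ 4 + i
shiftCol-≥ (s≤s (s≤s (s≤s (s≤s _)))) = refl

col : V → ℕ
col = proj₂

Left Inserted Right : V → Set
Left w = col w < 4
Inserted w = 4 ≤ col w × col w < 8
Right w = 8 ≤ col w

inserted? : ∀ w → Dec (Inserted w)
inserted? w = 4 ℕ.≤? col w ×-dec col w ℕ.<? 8

shift-not-inserted : ∀ w → ¬ Inserted (shift w)
shift-not-inserted (s , i) (4≤ , <8) with i ℕ.<? 4
... | yes i<4 = ℕ.<⇒≱ i<4 (subst (4 ≤_) (shiftCol-< i<4) 4≤)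
... | no i≮4 = ℕ.<⇒≱ (subst (_< 8) (shiftCol-≥ (ℕ.≮⇒≥ i≮4)) <8) (ℕ.+-monoʳ-≤ 4 (ℕ.≮⇒≥ i≮4))

-- An entry ((u , v) , p) replaces the crossing arc uv by the path  shift u , p , shift v.
detourTable : List ((V × V) × List V)
detourTable =
    ((xv 2 , xv 4) , xv 4 ∷ xv 6 ∷ [])
  ∷ ((xv 2 , yv 4) , yv 4 ∷ xv 4 ∷ yv 6 ∷ xv 6 ∷ [])
  ∷ ((yv 2 , xv 4) , xv 4 ∷ yv 4 ∷ xv 6 ∷ yv 6 ∷ [])
  ∷ ((yv 2 , yv 4) , yv 4 ∷ yv 6 ∷ [])
  ∷ ((xv 3 , xv 4) , xv 4 ∷ xv 5 ∷ xv 6 ∷ xv 7 ∷ [])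
  ∷ ((xv 3 , yv 4) , yv 4 ∷ xv 5 ∷ yv 6 ∷ xv 7 ∷ [])
  ∷ ((yv 3 , xv 4) , xv 4 ∷ yv 5 ∷ xv 6 ∷ yv 7 ∷ [])
  ∷ ((yv 3 , yv 4) , yv 4 ∷ yv 5 ∷ yv 6 ∷ yv 7 ∷ [])
  ∷ ((xv 3 , xv 5) , xv 5 ∷ xv 7 ∷ [])
  ∷ ((xv 3 , yv 5) , yv 5 ∷ xv 7 ∷ [])
  ∷ ((yv 3 , xv 5) , xv 5 ∷ yv 7 ∷ [])
  ∷ ((yv 3 , yv 5) , yv 5 ∷ yv 7 ∷ [])
  ∷ ((xv 4 , xv 2) , xv 6 ∷ xv 4 ∷ [])
  ∷ ((xv 4 , yv 2) , yv 6 ∷ xv 4 ∷ [])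
  ∷ ((yv 4 , xv 2) , xv 6 ∷ yv 4 ∷ [])
  ∷ ((yv 4 , yv 2) , yv 6 ∷ yv 4 ∷ [])
  ∷ ((xv 4 , xv 3) , xv 7 ∷ xv 6 ∷ xv 5 ∷ xv 4 ∷ [])
  ∷ ((xv 4 , yv 3) , yv 7 ∷ xv 6 ∷ yv 5 ∷ xv 4 ∷ [])
  ∷ ((yv 4 , xv 3) , xv 7 ∷ yv 6 ∷ xv 5 ∷ yv 4 ∷ [])
  ∷ ((yv 4 , yv 3) , yv 7 ∷ yv 6 ∷ yv 5 ∷ yv 4 ∷ [])
  ∷ ((xv 5 , xv 3) , xv 7 ∷ xv 5 ∷ [])
  ∷ ((xv 5 , yv 3) , yv 7 ∷ xv 7 ∷ yv 5 ∷ xv 5 ∷ [])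
  ∷ ((yv 5 , xv 3) , xv 7 ∷ yv 7 ∷ xv 5 ∷ yv 5 ∷ [])
  ∷ ((yv 5 , yv 3) , yv 7 ∷ yv 5 ∷ [])
  ∷ []

crossingArcs : List (V × V)
crossingArcs = map proj₁ detourTable

detourIn : List ((V × V) × List V) → V × V → List V
detourIn [] e = []
detourIn ((e′ , p) ∷ t) e = if does (e ≟ᵃ e′) then p else detourIn t e

detour : V × V → List V
detour = detourIn detourTable

segment : V × V → List V
segment (u , v) = shift u ∷ detour (u , v)

liftArc : V × V → List (V × V)
liftArc (u , v) = pathArcs (segment (u , v) ++ shift v ∷ [])

insertColumns : List V → List V
insertColumns c = concatMap segment (cycleArcs c)

detoursOf : List V → List V
detoursOf c = concatMap detour (cycleArcs c)

SameSide : V × V → Set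
SameSide (u , v) = (Left u × Left v) ⊎ (4 ≤ col u × 4 ≤ col v)

-- Opaque, so that unification never unfolds these proofs and reruns the decision procedures.
opaque
  crossingArcs-touch-inserted : All (λ (u , v) → Inserted u ⊎ Inserted v) crossingArcs
  crossingArcs-touch-inserted =
    from-yes (All.all? (λ (u , v) → inserted? u ⊎-dec inserted? v) crossingArcs)

  crossingArcs-touch-left : All (λ (u , v) → Left u ⊎ Left v) crossingArcs
  crossingArcs-touch-left =
    from-yes (All.all? (λ (u , v) → col u ℕ.<? 4 ⊎-dec col v ℕ.<? 4) crossingArcs)

  crossingArcs-in-J₆ : All (λ (u , v) → Arc 6 u v) crossingArcs
  crossingArcs-in-J₆ = from-yes (All.all? (λ (u , v) → arc? 6 u v) crossingArcs)

  detours-inserted : All (All Inserted ∘ proj₂) detourTable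
  detours-inserted = from-yes (All.all? (λ (_ , p) → All.all? inserted? p) detourTable)

  J₆-arcs-sameSide-or-crossing : All (λ a → SameSide a ⊎ a ∈ crossingArcs) (jArcs 6)
  J₆-arcs-sameSide-or-crossing = from-yes (All.all? (λ (u , v) →
    ((col u ℕ.<? 4 ×-dec col v ℕ.<? 4) ⊎-dec (4 ℕ.≤? col u ×-dec 4 ℕ.≤? col v))
    ⊎-dec (u , v) ∈ᵃ? crossingArcs) (jArcs 6))

  liftArc-crossing-in-J₁₀ : All (λ e → All (λ (u , v) → Arc 10 u v) (liftArc e)) crossingArcs
  liftArc-crossing-in-J₁₀ =
    from-yes (All.all? (λ e → All.all? (λ (u , v) → arc? 10 u v) (liftArc e)) crossingArcs)

  liftArc-crossing-touch-inserted :
    All (λ e → All (λ (u , v) → Inserted u ⊎ Inserted v) (liftArc e)) crossingArcs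
  liftArc-crossing-touch-inserted =
    from-yes (All.all? (λ e → All.all? (λ (u , v) → inserted? u ⊎-dec inserted? v) (liftArc e)) crossingArcs)

  liftArc-crossing-disjoint :
    All (λ e → All (λ e′ → e ≡ e′ ⊎ All (_∉ liftArc e′) (liftArc e)) crossingArcs) crossingArcs
  liftArc-crossing-disjoint = from-yes (All.all? (λ e → All.all? (λ e′ →
    e ≟ᵃ e′ ⊎-dec All.all? (λ a → ¬? (a ∈ᵃ? liftArc e′)) (liftArc e)) crossingArcs) crossingArcs)

  -- The path replacing a crossing arc crosses the cut only in that arc: insertion can be repeated.
  liftArc-crossing-detours : All (λ e → concatMap detour (liftArc e) ≡ detour e) crossingArcs
  liftArc-crossing-detours =
    from-yes (All.all? (λ e → List.≡-dec _≟ᵛ_ (concatMap detour (liftArc e)) (detour e)) crossingArcs)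

  window-covered : All (λ (u , v) → ¬ (Left u × Left v) → ¬ (Right u × Right v) →
    Any (λ e → (u , v) ∈ liftArc e) crossingArcs) (jArcs 10)
  window-covered = from-yes (All.all? (λ (u , v) →
    ¬? (col u ℕ.<? 4 ×-dec col v ℕ.<? 4) →-dec ¬? (8 ℕ.≤? col u ×-dec 8 ℕ.≤? col v) →-dec
    Any.any? (λ e → (u , v) ∈ᵃ? liftArc e) crossingArcs) (jArcs 10))

detourIn-∉ : ∀ t {e} → e ∉ map proj₁ t → detourIn t e ≡ []
detourIn-∉ [] _ = refl
detourIn-∉ ((e′ , _) ∷ t) {e} e∉ with e ≟ᵃ e′
... | yes e≡e′ = ⊥-elim (e∉ (here e≡e′))
... | no _ = detourIn-∉ t (e∉ ∘ there)

detourIn-all : ∀ {P : V → Set} t {e} → All (All P ∘ proj₂) t → All P (detourIn t e)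
detourIn-all [] [] = []
detourIn-all ((e′ , _) ∷ t) {e} (p ∷ ps) with e ≟ᵃ e′
... | yes _ = p
... | no _ = detourIn-all t ps

detour-∉ : ∀ {e} → e ∉ crossingArcs → detour e ≡ []
detour-∉ = detourIn-∉ detourTable

detour-inserted : ∀ e → All Inserted (detour e)
detour-inserted e = detourIn-all detourTable {e} detours-inserted

shifted-untouched : ∀ u v → ¬ (Inserted (shift u) ⊎ Inserted (shift v))
shifted-untouched u v = [ shift-not-inserted u , shift-not-inserted v ]

shifted-∉ : ∀ {u v} → (shift u , shift v) ∉ crossingArcs
shifted-∉ {u} {v} uv∈ = shifted-untouched u v (All.lookup crossingArcs-touch-inserted uv∈)

liftArc-∉ : ∀ {u v} → (u , v) ∉ crossingArcs → liftArc (u , v) ≡ (shift u , shift v) ∷ []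
liftArc-∉ {u} {v} uv∉ = cong (λ p → pathArcs (shift u ∷ p ++ shift v ∷ [])) (detour-∉ uv∉)

∈-liftArc-∉ : ∀ {u v a} → (u , v) ∉ crossingArcs → a ∈ liftArc (u , v) → a ≡ (shift u , shift v)
∈-liftArc-∉ uv∉ a∈ with here a≡ ← subst (_ ∈_) (liftArc-∉ uv∉) a∈ = a≡

shifted∈liftArc : ∀ {u v} → (u , v) ∉ crossingArcs → (shift u , shift v) ∈ liftArc (u , v)
shifted∈liftArc {u} {v} uv∉ = subst ((shift u , shift v) ∈_) (sym (liftArc-∉ uv∉)) (here refl)

sameSide-or-crossing : ∀ {m u v} → Arc m u v → SameSide (u , v) ⊎ (u , v) ∈ crossingArcs
sameSide-or-crossing {u = s , i} {t , j} uv with i ℕ.<? 4 | j ℕ.<? 4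
... | yes i<4 | yes j<4 = inj₁ (inj₁ (i<4 , j<4))
... | no i≮4 | no j≮4 = inj₁ (inj₂ (ℕ.≮⇒≥ i≮4 , ℕ.≮⇒≥ j≮4))
... | yes i<4 | no _ = All.lookup J₆-arcs-sameSide-or-crossing
  (∈-jArcs⁺ (uncurry Arc-restrict (near-bounded i<4 (proj₁ (Arc-near uv))) uv))
... | no _ | yes j<4 = All.lookup J₆-arcs-sameSide-or-crossing
  (∈-jArcs⁺ (uncurry Arc-restrict (swap (near-bounded j<4 (proj₂ (Arc-near uv)))) uv))

Arc-shift : ∀ {m u v} → Arc m u v → (u , v) ∉ crossingArcs → Arc (4 + m) (shift u) (shift v)
Arc-shift {m} {s , i} {t , j} uv uv∉ with sameSide-or-crossing uv
... | inj₂ uv∈ = ⊥-elim (uv∉ uv∈)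
... | inj₁ (inj₁ (i<4 , j<4)) rewrite shiftCol-< i<4 | shiftCol-< j<4 = Arc-mono (ℕ.m≤n+m m 4) uv
... | inj₁ (inj₂ (4≤i , 4≤j)) rewrite shiftCol-≥ 4≤i | shiftCol-≥ 4≤j = Arc-translate 4 uv

liftArc-arcs : ∀ {m u v a} → 6 ≤ m → Arc m u v → a ∈ liftArc (u , v) → Arc (4 + m) (proj₁ a) (proj₂ a)
liftArc-arcs {u = u} {v} 6≤m uv a∈ with (u , v) ∈ᵃ? crossingArcs
... | yes uv∈ = Arc-mono (ℕ.+-monoʳ-≤ 4 6≤m) (All.lookup (All.lookup liftArc-crossing-in-J₁₀ uv∈) a∈)
... | no uv∉ with refl ← ∈-liftArc-∉ uv∉ a∈ = Arc-shift uv uv∉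

liftArc-disjoint : ∀ {a e e′} → a ∈ liftArc e → a ∈ liftArc e′ → e ≡ e′
liftArc-disjoint {a} {e@(u , v)} {e′@(u′ , v′)} a∈ a∈′ with e ∈ᵃ? crossingArcs | e′ ∈ᵃ? crossingArcs
... | yes e∈ | yes e′∈ = [ id , (λ a∉ → ⊥-elim (All.lookup a∉ a∈ a∈′)) ]
  (All.lookup (All.lookup liftArc-crossing-disjoint e∈) e′∈)
... | yes e∈ | no e′∉ with refl ← ∈-liftArc-∉ e′∉ a∈′ =
  ⊥-elim (shifted-untouched u′ v′ (All.lookup (All.lookup liftArc-crossing-touch-inserted e∈) a∈))
... | no e∉ | yes e′∈ with refl ← ∈-liftArc-∉ e∉ a∈ =
  ⊥-elim (shifted-untouched u v (All.lookup (All.lookup liftArc-crossing-touch-inserted e′∈) a∈′))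
... | no e∉ | no e′∉ with eq ← trans (sym (∈-liftArc-∉ e∉ a∈)) (∈-liftArc-∉ e′∉ a∈′) =
  cong₂ _,_ (shift-injective (cong proj₁ eq)) (shift-injective (cong proj₂ eq))

detours-liftArc : ∀ e → concatMap detour (liftArc e) ≡ detour e
detours-liftArc (u , v) with (u , v) ∈ᵃ? crossingArcs
... | yes uv∈ = All.lookup liftArc-crossing-detours uv∈
... | no uv∉ = begin
  concatMap detour (liftArc (u , v))   ≡⟨ cong (concatMap detour) (liftArc-∉ uv∉) ⟩
  detour (shift u , shift v) ++ []     ≡⟨ cong (_++ []) (detour-∉ (shifted-∉ {u} {v})) ⟩
  []                                   ≡⟨ sym (detour-∉ uv∉) ⟩
  detour (u , v)                       ∎
  where open ≡-Reasoning

InLift : ℕ → V × V → Set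
InLift m a = ∃ λ e → Arc m (proj₁ e) (proj₂ e) × a ∈ liftArc e

cover-left : ∀ {m s i t j} → 4 ≤ m → Arc (4 + m) (s , i) (t , j) → i < 4 × j < 4 → InLift m ((s , i) , (t , j))
cover-left {m} {s} {i} {t} {j} 4≤m uv (i<4 , j<4) =
  ((s , i) , (t , j)) , Arc-restrict (below-m i<4) (below-m j<4) uv ,
  subst₂ (λ i′ j′ → ((s , i′) , (t , j′)) ∈ liftArc ((s , i) , (t , j)))
    (shiftCol-< i<4) (shiftCol-< j<4) (shifted∈liftArc uv∉)
  where
  below-m : ∀ {n} → n < 4 → n ≤ m
  below-m n<4 = ℕ.≤-trans (ℕ.<⇒≤ n<4) 4≤m
  uv∉ : ((s , i) , (t , j)) ∉ crossingArcs
  uv∉ uv∈ = [ (λ (4≤i , _) → ℕ.<⇒≱ i<4 4≤i) , (λ (4≤j , _) → ℕ.<⇒≱ j<4 4≤j) ]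
    (All.lookup crossingArcs-touch-inserted uv∈)

unshifted-∉ : ∀ {s t a b} → ((s , 4 + a) , (t , 4 + b)) ∉ crossingArcs
unshifted-∉ {a = a} {b} e∈ =
  [ (λ lt → ℕ.<⇒≱ lt (ℕ.m≤m+n 4 a)) , (λ lt → ℕ.<⇒≱ lt (ℕ.m≤m+n 4 b)) ] (All.lookup crossingArcs-touch-left e∈)

cover-right : ∀ {m s i t j} → Arc (4 + m) (s , i) (t , j) → 8 ≤ i × 8 ≤ j → InLift m ((s , i) , (t , j))
cover-right {s = s} {t = t} uv (8≤i , 8≤j)
  with a , refl ← ℕ.m≤n⇒∃[o]m+o≡n 8≤i | b , refl ← ℕ.m≤n⇒∃[o]m+o≡n 8≤j =
  ((s , 4 + a) , (t , 4 + b)) , Arc-untranslate 4 (s≤s z≤n) (s≤s z≤n) uv , shifted∈liftArc unshifted-∉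

window-bounds : ∀ {m s i t j} → Arc m (s , i) (t , j) → ¬ (8 ≤ i × 8 ≤ j) → i ≤ 10 × j ≤ 10
window-bounds {i = i} {j = j} uv ¬right with i ℕ.<? 8 | j ℕ.<? 8
... | yes i<8 | _ = near-bounded i<8 (proj₁ (Arc-near uv))
... | no _ | yes j<8 = swap (near-bounded j<8 (proj₂ (Arc-near uv)))
... | no i≮8 | no j≮8 = ⊥-elim (¬right (ℕ.≮⇒≥ i≮8 , ℕ.≮⇒≥ j≮8))

cover-window : ∀ {m s i t j} → 6 ≤ m → Arc (4 + m) (s , i) (t , j) →
  ¬ (i < 4 × j < 4) → ¬ (8 ≤ i × 8 ≤ j) → InLift m ((s , i) , (t , j))
cover-window 6≤m uv ¬left ¬right
  with e , e∈ , uv∈ ← find (All.lookup window-covered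
                              (∈-jArcs⁺ (uncurry Arc-restrict (window-bounds uv ¬right) uv)) ¬left ¬right) =
  e , Arc-mono 6≤m (All.lookup crossingArcs-in-J₆ e∈) , uv∈

liftArc-covers : ∀ {m u v} → 6 ≤ m → Arc (4 + m) u v → InLift m (u , v)
liftArc-covers {u = _ , i} {_ , j} 6≤m uv with i ℕ.<? 4 ×-dec j ℕ.<? 4 | 8 ℕ.≤? i ×-dec 8 ℕ.≤? j
... | yes left | _ = cover-left (ℕ.≤-trans (ℕ.m≤m+n 4 2) 6≤m) uv left
... | no _ | yes right = cover-right uv right
... | no ¬left | no ¬right = cover-window 6≤m uv ¬left ¬right

insertColumnsPath : List V → List V
insertColumnsPath [] = []
insertColumnsPath (v ∷ []) = shift v ∷ []
insertColumnsPath (u ∷ v ∷ p) = segment (u , v) ++ insertColumnsPath (v ∷ p)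

pathArcs-insertColumnsPath : ∀ p → pathArcs (insertColumnsPath p) ≡ concatMap liftArc (pathArcs p)
pathArcs-insertColumnsPath [] = refl
pathArcs-insertColumnsPath (v ∷ []) = refl
pathArcs-insertColumnsPath (u ∷ v ∷ []) = sym (List.++-identityʳ (liftArc (u , v)))
pathArcs-insertColumnsPath (u ∷ v ∷ w ∷ p) = begin
  pathArcs (segment (u , v) ++ shift v ∷ detour (v , w) ++ insertColumnsPath (w ∷ p))
    ≡⟨ pathArcs-++ (segment (u , v)) (shift v) (detour (v , w) ++ insertColumnsPath (w ∷ p)) ⟩
  liftArc (u , v) ++ pathArcs (insertColumnsPath (v ∷ w ∷ p))
    ≡⟨ cong (liftArc (u , v) ++_) (pathArcs-insertColumnsPath (v ∷ w ∷ p)) ⟩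
  liftArc (u , v) ++ concatMap liftArc (pathArcs (v ∷ w ∷ p)) ∎
  where open ≡-Reasoning

segments-insertColumnsPath : ∀ u p z →
  concatMap segment (pathArcs (u ∷ p ++ z ∷ [])) ++ shift z ∷ [] ≡ insertColumnsPath (u ∷ p ++ z ∷ [])
segments-insertColumnsPath u [] z = cong (_++ shift z ∷ []) (List.++-identityʳ (segment (u , z)))
segments-insertColumnsPath u (w ∷ p) z = begin
  (segment (u , w) ++ concatMap segment (pathArcs (w ∷ p ++ z ∷ []))) ++ shift z ∷ []
    ≡⟨ List.++-assoc (segment (u , w)) _ _ ⟩
  segment (u , w) ++ (concatMap segment (pathArcs (w ∷ p ++ z ∷ [])) ++ shift z ∷ [])
    ≡⟨ cong (segment (u , w) ++_) (segments-insertColumnsPath w p z) ⟩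
  segment (u , w) ++ insertColumnsPath (w ∷ p ++ z ∷ []) ∎
  where open ≡-Reasoning

insertColumns-∷ : ∀ v vs → ∃ λ rest → insertColumns (v ∷ vs) ≡ shift v ∷ rest
insertColumns-∷ v [] = _ , refl
insertColumns-∷ v (w ∷ ws) = _ , refl

cycleArcs-insertColumns : ∀ c → cycleArcs (insertColumns c) ≡ concatMap liftArc (cycleArcs c)
cycleArcs-insertColumns [] = refl
cycleArcs-insertColumns (v ∷ vs) with rest , eq ← insertColumns-∷ v vs = begin
  cycleArcs (insertColumns (v ∷ vs))
    ≡⟨ cong cycleArcs eq ⟩
  cycleArcs (shift v ∷ rest)
    ≡⟨ cycleArcs-pathArcs (shift v) rest ⟩
  pathArcs (shift v ∷ rest ++ shift v ∷ [])
    ≡⟨ cong (λ c → pathArcs (c ++ shift v ∷ [])) (sym eq) ⟩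
  pathArcs (concatMap segment (cycleArcs (v ∷ vs)) ++ shift v ∷ [])
    ≡⟨ cong (λ as → pathArcs (concatMap segment as ++ shift v ∷ [])) (cycleArcs-pathArcs v vs) ⟩
  pathArcs (concatMap segment (pathArcs (v ∷ vs ++ v ∷ [])) ++ shift v ∷ [])
    ≡⟨ cong pathArcs (segments-insertColumnsPath v vs v) ⟩
  pathArcs (insertColumnsPath (v ∷ vs ++ v ∷ []))
    ≡⟨ pathArcs-insertColumnsPath (v ∷ vs ++ v ∷ []) ⟩
  concatMap liftArc (pathArcs (v ∷ vs ++ v ∷ []))
    ≡⟨ cong (concatMap liftArc) (sym (cycleArcs-pathArcs v vs)) ⟩
  concatMap liftArc (cycleArcs (v ∷ vs)) ∎
  where open ≡-Reasoning

detoursOf-insertColumns : ∀ c → detoursOf (insertColumns c) ≡ detoursOf c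
detoursOf-insertColumns c = begin
  concatMap detour (cycleArcs (insertColumns c))       ≡⟨ cong (concatMap detour) (cycleArcs-insertColumns c) ⟩
  concatMap detour (concatMap liftArc (cycleArcs c))   ≡⟨ concatMap-concatMap detour liftArc (cycleArcs c) ⟩
  concatMap (concatMap detour ∘ liftArc) (cycleArcs c) ≡⟨ List.concatMap-cong detours-liftArc (cycleArcs c) ⟩
  concatMap detour (cycleArcs c)                       ∎
  where open ≡-Reasoning

arcsOf-insertColumns : ∀ cs →
  concatMap cycleArcs (map insertColumns cs) ≡ concatMap liftArc (concatMap cycleArcs cs)
arcsOf-insertColumns [] = refl
arcsOf-insertColumns (c ∷ cs) = begin
  cycleArcs (insertColumns c) ++ concatMap cycleArcs (map insertColumns cs)
    ≡⟨ cong₂ _++_ (cycleArcs-insertColumns c) (arcsOf-insertColumns cs) ⟩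
  concatMap liftArc (cycleArcs c) ++ concatMap liftArc (concatMap cycleArcs cs)
    ≡⟨ sym (List.concatMap-++ liftArc (cycleArcs c) (concatMap cycleArcs cs)) ⟩
  concatMap liftArc (concatMap cycleArcs (c ∷ cs)) ∎
  where open ≡-Reasoning

∈-arcsOf-insertColumns⁻ : ∀ cs {a} → a ∈ concatMap cycleArcs (map insertColumns cs) →
  ∃ λ e → e ∈ concatMap cycleArcs cs × a ∈ liftArc e
∈-arcsOf-insertColumns⁻ cs a∈ = find (∈-concatMap⁻ liftArc (subst (_ ∈_) (arcsOf-insertColumns cs) a∈))

∈-arcsOf-insertColumns⁺ : ∀ cs {a e} → e ∈ concatMap cycleArcs cs → a ∈ liftArc e →
  a ∈ concatMap cycleArcs (map insertColumns cs)
∈-arcsOf-insertColumns⁺ cs e∈ a∈ =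
  subst (_ ∈_) (sym (arcsOf-insertColumns cs)) (∈-concatMap⁺ liftArc (lose e∈ a∈))

detoursOf-inserted : ∀ cs → All Inserted (concatMap detoursOf cs)
detoursOf-inserted cs =
  concat⁺ (map⁺ (All.universal (λ c → concat⁺ (map⁺ (All.universal detour-inserted (cycleArcs c)))) cs))

insertColumns-↭ : ∀ c → insertColumns c ↭ map shift c ++ detoursOf c
insertColumns-↭ c = begin
  insertColumns c
    ↭⟨ concatMap-∷-↭ (shift ∘ proj₁) detour (cycleArcs c) ⟩
  map (shift ∘ proj₁) (cycleArcs c) ++ detoursOf c
    ≡⟨ cong (_++ detoursOf c) (List.map-∘ (cycleArcs c)) ⟩
  map shift (map proj₁ (cycleArcs c)) ++ detoursOf c
    ≡⟨ cong (λ c′ → map shift c′ ++ detoursOf c) (map-proj₁-cycleArcs c) ⟩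
  map shift c ++ detoursOf c ∎
  where open PermutationReasoning

concat-insertColumns-↭ : ∀ cs →
  concat (map insertColumns cs) ↭ map shift (concat cs) ++ concatMap detoursOf cs
concat-insertColumns-↭ [] = ↭-refl
concat-insertColumns-↭ (c ∷ cs) = begin
  insertColumns c ++ concat (map insertColumns cs)
    ↭⟨ ++⁺ (insertColumns-↭ c) (concat-insertColumns-↭ cs) ⟩
  (map shift c ++ detoursOf c) ++ (map shift (concat cs) ++ concatMap detoursOf cs)
    ≡⟨ List.++-assoc (map shift c) (detoursOf c) _ ⟩
  map shift c ++ detoursOf c ++ map shift (concat cs) ++ concatMap detoursOf cs
    ↭⟨ ++⁺ˡ (map shift c) (shifts (detoursOf c) (map shift (concat cs))) ⟩
  map shift c ++ map shift (concat cs) ++ detoursOf c ++ concatMap detoursOf cs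
    ≡⟨ sym (List.++-assoc (map shift c) (map shift (concat cs)) _) ⟩
  (map shift c ++ map shift (concat cs)) ++ concatMap detoursOf (c ∷ cs)
    ≡⟨ cong (_++ concatMap detoursOf (c ∷ cs)) (sym (List.map-++ shift c (concat cs))) ⟩
  map shift (c ++ concat cs) ++ concatMap detoursOf (c ∷ cs) ∎
  where open PermutationReasoning

shift-∈-insertColumns : ∀ cs w → shift w ∈ concat (map insertColumns cs) ⇔ w ∈ concat cs
shift-∈-insertColumns cs w = mk⇔ to (λ w∈ → ∈-resp-↭ (↭-sym perm) (∈-++⁺ˡ (∈-map⁺ shift w∈)))
  where
  perm = concat-insertColumns-↭ cs
  to : shift w ∈ concat (map insertColumns cs) → w ∈ concat cs
  to w∈ with ∈-++⁻ (map shift (concat cs)) (∈-resp-↭ perm w∈)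
  ... | inj₁ w∈shifted with _ , x∈ , eq ← ∈-map⁻ shift w∈shifted =
    subst (_∈ concat cs) (sym (shift-injective eq)) x∈
  ... | inj₂ w∈detours = ⊥-elim (shift-not-inserted w (All.lookup (detoursOf-inserted cs) w∈detours))

unique-insertColumns : ∀ cs → Unique (concat cs) → Unique (concatMap detoursOf cs) →
  Unique (concat (map insertColumns cs))
unique-insertColumns cs unique unique-detours =
  PermSetoid.Unique-resp-↭ (setoid V) (↭⇒↭ₛ (↭-sym (concat-insertColumns-↭ cs)))
    (Unique.++⁺ (Unique.map⁺ shift-injective unique) unique-detours disjoint)
  where
  disjoint : Disjoint (map shift (concat cs)) (concatMap detoursOf cs)
  disjoint (w∈ , w∈detours) with x , _ , refl ← ∈-map⁻ shift w∈ =
    shift-not-inserted x (All.lookup (detoursOf-inserted cs) w∈detours)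

length-insertColumns : ∀ c → length (insertColumns c) ≡ length c + length (detoursOf c)
length-insertColumns c = begin
  length (insertColumns c)                     ≡⟨ ↭-length (insertColumns-↭ c) ⟩
  length (map shift c ++ detoursOf c)          ≡⟨ List.length-++ (map shift c) ⟩
  length (map shift c) + length (detoursOf c)  ≡⟨ cong (_+ length (detoursOf c)) (List.length-map shift c) ⟩
  length c + length (detoursOf c)              ∎
  where open ≡-Reasoning

Insertable : List (List V) → Set
Insertable [] = ⊥
Insertable (c ∷ cs) = Unique (detoursOf c) × length (detoursOf c) ≡ 8 × All (λ c′ → detoursOf c′ ≡ []) cs

insertable? : ∀ cs → Dec (Insertable cs)
insertable? [] = no id
insertable? (c ∷ cs) =
  unique? (detoursOf c) ×-dec length (detoursOf c) ℕ.≟ 8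
  ×-dec All.all? (λ c′ → List.≡-dec _≟ᵛ_ (detoursOf c′) []) cs

insertable-unique : ∀ cs → Insertable cs → Unique (concatMap detoursOf cs)
insertable-unique (c ∷ cs) (unique , _ , none) =
  subst Unique (sym (trans (cong (detoursOf c ++_) (vanish none)) (List.++-identityʳ (detoursOf c)))) unique
  where
  vanish : ∀ {cs} → All (λ c′ → detoursOf c′ ≡ []) cs → concatMap detoursOf cs ≡ []
  vanish [] = refl
  vanish (d ∷ ds) = trans (cong (_++ _) d) (vanish ds)

insertable-insertColumns : ∀ cs → Insertable cs → Insertable (map insertColumns cs)
insertable-insertColumns (c ∷ cs) (unique , length≡8 , none) rewrite detoursOf-insertColumns c =
  unique , length≡8 , map⁺ (All.map (λ {c′} → trans (detoursOf-insertColumns c′)) none)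

shape-insertColumns : ∀ {ℓ L} cs → map length cs ≡ ℓ ∷ L → Insertable cs →
  map length (map insertColumns cs) ≡ ℓ + 8 ∷ L
shape-insertColumns (c ∷ cs) shape≡ (_ , length≡8 , none) =
  cong₂ _∷_ (trans (length-insertColumns c) (cong₂ _+_ (List.∷-injectiveˡ shape≡) length≡8))
            (trans (unchanged none) (List.∷-injectiveʳ shape≡))
  where
  unchanged : ∀ {cs} → All (λ c′ → detoursOf c′ ≡ []) cs → map length (map insertColumns cs) ≡ map length cs
  unchanged [] = refl
  unchanged {c′ ∷ _} (d ∷ ds) = cong₂ _∷_
    (trans (length-insertColumns c′) (trans (cong (λ p → length c′ + length p) d) (ℕ.+-identityʳ _)))
    (unchanged ds)

insertColumnsCopy : ∀ {ℓ L} (C : Copy (ℓ ∷ L)) → Insertable (cycles C) → Copy (ℓ + 8 ∷ L)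
insertColumnsCopy C ins = record
  { cycles = map insertColumns (cycles C)
  ; shape = shape-insertColumns (cycles C) (shape C) ins
  ; distinct = unique-insertColumns (cycles C) (distinct C) (insertable-unique (cycles C) ins)
  }

module _ {ℓ L} (C : Copy (ℓ ∷ L)) (ins : Insertable (cycles C)) where

  private
    C′ = insertColumnsCopy C ins

  isSubJ-insertColumns : ∀ {m} → 6 ≤ m → IsSubJ m C → IsSubJ (4 + m) C′
  isSubJ-insertColumns 6≤m sub _ _ uv∈
    with (p , q) , e∈ , uv∈lift ← ∈-arcsOf-insertColumns⁻ (cycles C) uv∈ =
    liftArc-arcs 6≤m (sub p q e∈) uv∈lift

  exactlyOne-insertColumns : ∀ {u v} → ExactlyOne C u v → ExactlyOne C′ (shift u) (shift v)
  exactlyOne-insertColumns {u} {v} (one , ¬both) =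
    Sum.map (from (∈C′ u)) (from (∈C′ v)) one , λ (u∈ , v∈) → ¬both (to (∈C′ u) u∈ , to (∈C′ v) v∈)
    where
    open Equivalence
    ∈C′ = shift-∈-insertColumns (cycles C)

  admissible-insertColumns : ∀ {m} → 6 ≤ m → Admissible m C → Admissible (4 + m) C′
  admissible-insertColumns {m} 6≤m (sub , ex₀ , ex₁ , ey₀ , ey₁) =
    isSubJ-insertColumns 6≤m sub ,
    far 4≤m (exactlyOne-insertColumns ex₀) , far 4≤1+m (exactlyOne-insertColumns ex₁) ,
    far 4≤m (exactlyOne-insertColumns ey₀) , far 4≤1+m (exactlyOne-insertColumns ey₁)
    where
    4≤m : 4 ≤ m
    4≤m = ℕ.≤-trans (ℕ.m≤m+n 4 2) 6≤m
    4≤1+m : 4 ≤ suc m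
    4≤1+m = ℕ.m≤n⇒m≤1+n 4≤m
    far : ∀ {w s j} → 4 ≤ j → ExactlyOne C′ w (s , shiftCol j) → ExactlyOne C′ w (s , 4 + j)
    far {w} {s} 4≤j = subst (λ i → ExactlyOne C′ w (s , i)) (shiftCol-≥ 4≤j)

  hasPattern-insertColumns : ∀ {P} → HasPattern C P → HasPattern C′ P
  hasPattern-insertColumns pat w w∈ext = ⇔.trans
    (subst (λ w′ → w′ ∈ vertsOf C′ ⇔ w ∈ vertsOf C) (shift-ext w∈ext) (shift-∈-insertColumns (cycles C) w))
    (pat w w∈ext)
    where
    shift-ext : ∀ {w} → w ∈ extVerts → shift w ≡ w
    shift-ext (here refl) = refl
    shift-ext (there (here refl)) = refl
    shift-ext (there (there (here refl))) = refl
    shift-ext (there (there (there (here refl)))) = refl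

InsertableDecomp : ℕ → List ℕ → Vec (List V) 9 → Set
InsertableDecomp m L P = Σ (AdmDecomp m L P) λ (F , _) → ∀ k → Insertable (cycles (F k))

insertColumns-decomp : ∀ {m ℓ L P} → 6 ≤ m →
  InsertableDecomp m (ℓ ∷ L) P → InsertableDecomp (4 + m) (ℓ + 8 ∷ L) P
insertColumns-decomp {m} {ℓ} {L} 6≤m ((F , admissible , patterns , disjoint , covers) , ins) =
  (F′ , (λ k → admissible-insertColumns (F k) (ins k) 6≤m (admissible k)) ,
        (λ k → hasPattern-insertColumns (F k) (ins k) (patterns k)) , disjoint′ , covers′) ,
  λ k → insertable-insertColumns (cycles (F k)) (ins k)
  where
  F′ : Fin 9 → Copy (ℓ + 8 ∷ L)
  F′ k = insertColumnsCopy (F k) (ins k)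
  disjoint′ : ArcDisjoint F′
  disjoint′ k k′ a a∈ a∈′
    with e , e∈ , a∈e ← ∈-arcsOf-insertColumns⁻ (cycles (F k)) a∈
       | e′ , e′∈ , a∈e′ ← ∈-arcsOf-insertColumns⁻ (cycles (F k′)) a∈′ =
    disjoint k k′ e e∈ (subst (_∈ arcsOf (F k′)) (sym (liftArc-disjoint a∈e a∈e′)) e′∈)
  covers′ : Covers (4 + m) F′
  covers′ u v uv =
    let (p , q) , pq , uv∈ = liftArc-covers 6≤m uv
        k , e∈ = covers p q pq
    in k , ∈-arcsOf-insertColumns⁺ (cycles (F k)) e∈ uv∈

-- Explicit decompositions

insertableFromCycles : ∀ m L P (cs : Vec (List (List V)) 9)
  {copies : True (all? λ k → isCopy? L (lookup cs k))}
  {decomp : True (isAdmDecomp? m P λ k → toCopy (toWitness copies k))}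
  {insertable : True (all? λ k → insertable? (lookup cs k))} → InsertableDecomp m L P
insertableFromCycles m L P cs {copies} {decomp} {insertable} =
  fromCycles m L P cs {copies} {decomp} , toWitness insertable

[8] : AdmDecomp 4 (8 ∷ []) 𝒳
[8] = fromCycles 4 (8 ∷ []) 𝒳
  ( ((xv 2 ∷ yv 1 ∷ yv 3 ∷ xv 5 ∷ xv 3 ∷ xv 4 ∷ yv 4 ∷ yv 2 ∷ []) ∷ [])
  ∷ᵥ ((xv 0 ∷ xv 2 ∷ yv 2 ∷ xv 3 ∷ yv 4 ∷ yv 3 ∷ yv 1 ∷ xv 1 ∷ []) ∷ [])
  ∷ᵥ ((xv 1 ∷ yv 0 ∷ yv 1 ∷ yv 2 ∷ xv 4 ∷ yv 3 ∷ xv 2 ∷ xv 3 ∷ []) ∷ [])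
  ∷ᵥ ((xv 0 ∷ xv 1 ∷ xv 2 ∷ yv 0 ∷ yv 2 ∷ yv 3 ∷ xv 3 ∷ yv 1 ∷ []) ∷ [])
  ∷ᵥ ((xv 2 ∷ yv 4 ∷ xv 4 ∷ xv 3 ∷ xv 5 ∷ yv 3 ∷ yv 2 ∷ yv 1 ∷ []) ∷ [])
  ∷ᵥ ((xv 0 ∷ yv 2 ∷ yv 0 ∷ xv 1 ∷ yv 3 ∷ yv 5 ∷ xv 3 ∷ xv 2 ∷ []) ∷ [])
  ∷ᵥ ((xv 1 ∷ yv 1 ∷ xv 3 ∷ yv 3 ∷ yv 4 ∷ xv 2 ∷ xv 4 ∷ yv 2 ∷ []) ∷ [])
  ∷ᵥ ((xv 1 ∷ yv 2 ∷ yv 4 ∷ xv 3 ∷ yv 5 ∷ yv 3 ∷ xv 4 ∷ xv 2 ∷ []) ∷ [])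
  ∷ᵥ ((xv 0 ∷ yv 1 ∷ yv 0 ∷ xv 2 ∷ yv 3 ∷ xv 1 ∷ xv 3 ∷ yv 2 ∷ []) ∷ [])
  ∷ᵥ []ᵥ )

[10] : AdmDecomp 5 (10 ∷ []) 𝒳
[10] = fromCycles 5 (10 ∷ []) 𝒳
  ( ((xv 2 ∷ xv 3 ∷ xv 5 ∷ yv 4 ∷ xv 6 ∷ xv 4 ∷ yv 5 ∷ yv 3 ∷ yv 2 ∷ yv 1 ∷ []) ∷ [])
  ∷ᵥ ((xv 0 ∷ xv 1 ∷ yv 2 ∷ yv 4 ∷ yv 3 ∷ yv 5 ∷ xv 4 ∷ xv 3 ∷ xv 2 ∷ yv 1 ∷ []) ∷ [])
  ∷ᵥ ((xv 1 ∷ yv 0 ∷ yv 1 ∷ yv 3 ∷ xv 5 ∷ xv 4 ∷ yv 2 ∷ xv 2 ∷ yv 4 ∷ xv 3 ∷ []) ∷ [])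
  ∷ᵥ ((xv 0 ∷ xv 2 ∷ xv 1 ∷ xv 3 ∷ yv 4 ∷ xv 4 ∷ yv 3 ∷ yv 1 ∷ yv 0 ∷ yv 2 ∷ []) ∷ [])
  ∷ᵥ ((xv 2 ∷ xv 4 ∷ xv 6 ∷ yv 4 ∷ yv 5 ∷ xv 5 ∷ xv 3 ∷ yv 1 ∷ yv 2 ∷ yv 3 ∷ []) ∷ [])
  ∷ᵥ ((xv 0 ∷ yv 2 ∷ xv 3 ∷ yv 3 ∷ yv 4 ∷ yv 6 ∷ xv 4 ∷ xv 2 ∷ yv 0 ∷ xv 1 ∷ []) ∷ [])
  ∷ᵥ ((xv 1 ∷ yv 1 ∷ xv 3 ∷ yv 5 ∷ yv 4 ∷ xv 2 ∷ yv 2 ∷ xv 4 ∷ xv 5 ∷ yv 3 ∷ []) ∷ [])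
  ∷ᵥ ((xv 1 ∷ xv 2 ∷ yv 3 ∷ xv 4 ∷ yv 6 ∷ yv 4 ∷ xv 5 ∷ yv 5 ∷ xv 3 ∷ yv 2 ∷ []) ∷ [])
  ∷ᵥ ((xv 0 ∷ yv 1 ∷ xv 1 ∷ yv 3 ∷ xv 3 ∷ xv 4 ∷ yv 4 ∷ yv 2 ∷ yv 0 ∷ xv 2 ∷ []) ∷ [])
  ∷ᵥ []ᵥ )

[12] : InsertableDecomp 6 (12 ∷ []) 𝒳
[12] = insertableFromCycles 6 (12 ∷ []) 𝒳
  ( ((xv 2 ∷ yv 1 ∷ xv 3 ∷ yv 4 ∷ yv 6 ∷ yv 5 ∷ xv 7 ∷ xv 5 ∷ xv 6 ∷ xv 4 ∷ yv 3 ∷ yv 2 ∷ []) ∷ [])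
  ∷ᵥ ((xv 0 ∷ xv 2 ∷ xv 1 ∷ yv 2 ∷ yv 3 ∷ xv 4 ∷ yv 5 ∷ xv 5 ∷ yv 6 ∷ yv 4 ∷ xv 3 ∷ yv 1 ∷ []) ∷ [])
  ∷ᵥ ((xv 1 ∷ yv 0 ∷ yv 1 ∷ yv 2 ∷ yv 4 ∷ xv 4 ∷ xv 2 ∷ yv 3 ∷ yv 5 ∷ xv 6 ∷ xv 5 ∷ xv 3 ∷ []) ∷ [])
  ∷ᵥ ((xv 0 ∷ yv 2 ∷ xv 4 ∷ yv 4 ∷ xv 5 ∷ yv 5 ∷ xv 3 ∷ yv 3 ∷ xv 1 ∷ yv 1 ∷ yv 0 ∷ xv 2 ∷ []) ∷ [])
  ∷ᵥ ((xv 2 ∷ yv 2 ∷ xv 3 ∷ xv 4 ∷ xv 6 ∷ yv 6 ∷ xv 5 ∷ xv 7 ∷ yv 5 ∷ yv 4 ∷ yv 3 ∷ yv 1 ∷ []) ∷ [])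
  ∷ᵥ ((xv 0 ∷ xv 1 ∷ yv 3 ∷ yv 4 ∷ yv 5 ∷ yv 7 ∷ xv 5 ∷ xv 4 ∷ xv 3 ∷ xv 2 ∷ yv 0 ∷ yv 2 ∷ []) ∷ [])
  ∷ᵥ ((xv 1 ∷ xv 2 ∷ yv 4 ∷ xv 6 ∷ yv 5 ∷ yv 6 ∷ xv 4 ∷ xv 5 ∷ yv 3 ∷ xv 3 ∷ yv 2 ∷ yv 1 ∷ []) ∷ [])
  ∷ᵥ ((xv 1 ∷ xv 3 ∷ xv 5 ∷ yv 7 ∷ yv 5 ∷ yv 3 ∷ xv 2 ∷ xv 4 ∷ yv 6 ∷ xv 6 ∷ yv 4 ∷ yv 2 ∷ []) ∷ [])
  ∷ᵥ ((xv 0 ∷ yv 1 ∷ yv 3 ∷ xv 5 ∷ yv 4 ∷ xv 2 ∷ xv 3 ∷ yv 5 ∷ xv 4 ∷ yv 2 ∷ yv 0 ∷ xv 1 ∷ []) ∷ [])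
  ∷ᵥ []ᵥ )

[14] : InsertableDecomp 7 (14 ∷ []) 𝒳
[14] = insertableFromCycles 7 (14 ∷ []) 𝒳
  ( ((xv 2 ∷ yv 1 ∷ yv 3 ∷ yv 5 ∷ xv 7 ∷ yv 7 ∷ xv 5 ∷ xv 3 ∷ yv 2 ∷ yv 4 ∷ yv 6 ∷ xv 8 ∷ xv 6 ∷ xv 4 ∷ []) ∷ [])
  ∷ᵥ ((xv 0 ∷ yv 2 ∷ xv 2 ∷ yv 3 ∷ xv 4 ∷ yv 5 ∷ yv 6 ∷ yv 7 ∷ xv 6 ∷ xv 5 ∷ yv 4 ∷ xv 3 ∷ xv 1 ∷ yv 1 ∷ []) ∷ [])
  ∷ᵥ ((xv 1 ∷ yv 0 ∷ xv 2 ∷ xv 3 ∷ yv 4 ∷ xv 5 ∷ yv 6 ∷ xv 6 ∷ xv 7 ∷ yv 5 ∷ xv 4 ∷ yv 3 ∷ yv 2 ∷ yv 1 ∷ []) ∷ [])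
  ∷ᵥ ((xv 0 ∷ yv 1 ∷ yv 0 ∷ xv 1 ∷ xv 2 ∷ xv 4 ∷ yv 6 ∷ yv 5 ∷ yv 3 ∷ xv 3 ∷ xv 5 ∷ xv 6 ∷ yv 4 ∷ yv 2 ∷ []) ∷ [])
  ∷ᵥ ((xv 2 ∷ yv 2 ∷ yv 3 ∷ yv 4 ∷ yv 5 ∷ xv 5 ∷ yv 7 ∷ xv 7 ∷ xv 6 ∷ xv 8 ∷ yv 6 ∷ xv 4 ∷ xv 3 ∷ yv 1 ∷ []) ∷ [])
  ∷ᵥ ((xv 0 ∷ xv 2 ∷ yv 0 ∷ yv 2 ∷ xv 4 ∷ yv 4 ∷ xv 6 ∷ yv 8 ∷ yv 6 ∷ xv 5 ∷ yv 5 ∷ xv 3 ∷ yv 3 ∷ xv 1 ∷ []) ∷ [])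
  ∷ᵥ ((xv 1 ∷ xv 3 ∷ xv 2 ∷ yv 4 ∷ xv 4 ∷ xv 6 ∷ yv 5 ∷ yv 7 ∷ yv 6 ∷ xv 7 ∷ xv 5 ∷ yv 3 ∷ yv 1 ∷ yv 2 ∷ []) ∷ [])
  ∷ᵥ ((xv 1 ∷ yv 2 ∷ xv 3 ∷ xv 4 ∷ xv 5 ∷ xv 7 ∷ yv 6 ∷ yv 8 ∷ xv 6 ∷ yv 7 ∷ yv 5 ∷ yv 4 ∷ yv 3 ∷ xv 2 ∷ []) ∷ [])
  ∷ᵥ ((xv 0 ∷ xv 1 ∷ yv 3 ∷ xv 5 ∷ xv 4 ∷ yv 2 ∷ yv 0 ∷ yv 1 ∷ xv 3 ∷ yv 5 ∷ xv 6 ∷ yv 6 ∷ yv 4 ∷ xv 2 ∷ []) ∷ [])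
  ∷ᵥ []ᵥ )

[16] : InsertableDecomp 8 (16 ∷ []) 𝒳
[16] = insertableFromCycles 8 (16 ∷ []) 𝒳
  ( ((xv 2 ∷ yv 1 ∷ xv 3 ∷ yv 5 ∷ xv 4 ∷ yv 2 ∷ yv 3 ∷ xv 5 ∷ yv 7 ∷ xv 9 ∷ xv 7 ∷ xv 6 ∷ yv 8 ∷ xv 8 ∷ yv 6 ∷ yv 4 ∷ []) ∷ [])
  ∷ᵥ ((xv 0 ∷ xv 1 ∷ xv 3 ∷ xv 4 ∷ xv 5 ∷ xv 6 ∷ xv 7 ∷ yv 8 ∷ yv 7 ∷ yv 6 ∷ yv 5 ∷ yv 4 ∷ yv 3 ∷ xv 2 ∷ yv 2 ∷ yv 1 ∷ []) ∷ [])
  ∷ᵥ ((xv 1 ∷ yv 2 ∷ yv 4 ∷ xv 6 ∷ xv 8 ∷ xv 7 ∷ yv 7 ∷ xv 5 ∷ xv 3 ∷ yv 3 ∷ yv 5 ∷ yv 6 ∷ xv 4 ∷ xv 2 ∷ yv 0 ∷ yv 1 ∷ []) ∷ [])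
  ∷ᵥ ((xv 0 ∷ yv 2 ∷ xv 1 ∷ yv 3 ∷ yv 4 ∷ yv 6 ∷ xv 7 ∷ xv 5 ∷ yv 5 ∷ yv 7 ∷ xv 6 ∷ xv 4 ∷ xv 3 ∷ yv 1 ∷ yv 0 ∷ xv 2 ∷ []) ∷ [])
  ∷ᵥ ((xv 2 ∷ xv 4 ∷ yv 6 ∷ xv 8 ∷ yv 8 ∷ xv 6 ∷ yv 4 ∷ yv 2 ∷ xv 3 ∷ xv 5 ∷ xv 7 ∷ xv 9 ∷ yv 7 ∷ yv 5 ∷ yv 3 ∷ yv 1 ∷ []) ∷ [])
  ∷ᵥ ((xv 0 ∷ xv 2 ∷ yv 4 ∷ xv 4 ∷ xv 6 ∷ yv 6 ∷ yv 7 ∷ yv 9 ∷ xv 7 ∷ yv 5 ∷ xv 5 ∷ yv 3 ∷ xv 3 ∷ yv 2 ∷ yv 0 ∷ xv 1 ∷ []) ∷ [])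
  ∷ᵥ ((xv 1 ∷ yv 1 ∷ yv 2 ∷ xv 2 ∷ xv 3 ∷ yv 4 ∷ yv 5 ∷ xv 7 ∷ xv 8 ∷ yv 7 ∷ yv 8 ∷ yv 6 ∷ xv 6 ∷ xv 5 ∷ xv 4 ∷ yv 3 ∷ []) ∷ [])
  ∷ᵥ ((xv 1 ∷ xv 2 ∷ yv 3 ∷ yv 2 ∷ xv 4 ∷ yv 4 ∷ xv 5 ∷ yv 6 ∷ yv 8 ∷ xv 7 ∷ yv 9 ∷ yv 7 ∷ xv 8 ∷ xv 6 ∷ yv 5 ∷ xv 3 ∷ []) ∷ [])
  ∷ᵥ ((xv 0 ∷ yv 1 ∷ yv 3 ∷ xv 4 ∷ yv 5 ∷ xv 6 ∷ yv 7 ∷ xv 7 ∷ yv 6 ∷ xv 5 ∷ yv 4 ∷ xv 3 ∷ xv 2 ∷ xv 1 ∷ yv 0 ∷ yv 2 ∷ []) ∷ [])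
  ∷ᵥ []ᵥ )

[18] : InsertableDecomp 9 (18 ∷ []) 𝒳
[18] = insertableFromCycles 9 (18 ∷ []) 𝒳
  ( ((xv 2 ∷ yv 1 ∷ xv 3 ∷ yv 5 ∷ xv 6 ∷ yv 8 ∷ xv 10 ∷ xv 8 ∷ yv 9 ∷ xv 7 ∷ xv 9 ∷ yv 7 ∷ yv 6 ∷ xv 4 ∷ yv 2 ∷ yv 3 ∷ xv 5 ∷ yv 4 ∷ []) ∷ [])
  ∷ᵥ ((xv 0 ∷ xv 1 ∷ xv 3 ∷ xv 4 ∷ xv 6 ∷ yv 6 ∷ yv 8 ∷ xv 8 ∷ xv 7 ∷ yv 9 ∷ yv 7 ∷ xv 5 ∷ yv 5 ∷ yv 4 ∷ yv 3 ∷ xv 2 ∷ yv 2 ∷ yv 1 ∷ []) ∷ [])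
  ∷ᵥ ((xv 1 ∷ yv 2 ∷ yv 4 ∷ yv 6 ∷ xv 6 ∷ xv 8 ∷ xv 9 ∷ yv 8 ∷ yv 7 ∷ xv 7 ∷ xv 5 ∷ xv 3 ∷ yv 3 ∷ yv 5 ∷ xv 4 ∷ xv 2 ∷ yv 0 ∷ yv 1 ∷ []) ∷ [])
  ∷ᵥ ((xv 0 ∷ yv 1 ∷ yv 3 ∷ yv 4 ∷ yv 5 ∷ xv 5 ∷ xv 7 ∷ yv 8 ∷ yv 6 ∷ xv 8 ∷ yv 7 ∷ xv 6 ∷ xv 4 ∷ xv 3 ∷ xv 2 ∷ xv 1 ∷ yv 0 ∷ yv 2 ∷ []) ∷ [])
  ∷ᵥ ((xv 2 ∷ xv 4 ∷ yv 4 ∷ yv 2 ∷ xv 3 ∷ xv 5 ∷ xv 6 ∷ yv 7 ∷ xv 8 ∷ xv 10 ∷ yv 8 ∷ yv 9 ∷ xv 9 ∷ xv 7 ∷ yv 6 ∷ yv 5 ∷ yv 3 ∷ yv 1 ∷ []) ∷ [])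
  ∷ᵥ ((xv 0 ∷ xv 2 ∷ yv 4 ∷ xv 4 ∷ yv 5 ∷ yv 6 ∷ xv 7 ∷ yv 7 ∷ yv 8 ∷ yv 10 ∷ xv 8 ∷ xv 6 ∷ xv 5 ∷ yv 3 ∷ xv 3 ∷ yv 2 ∷ yv 0 ∷ xv 1 ∷ []) ∷ [])
  ∷ᵥ ((xv 1 ∷ yv 1 ∷ yv 2 ∷ xv 2 ∷ xv 3 ∷ yv 4 ∷ xv 6 ∷ xv 7 ∷ yv 5 ∷ yv 7 ∷ yv 9 ∷ yv 8 ∷ xv 9 ∷ xv 8 ∷ yv 6 ∷ xv 5 ∷ xv 4 ∷ yv 3 ∷ []) ∷ [])
  ∷ᵥ ((xv 1 ∷ xv 2 ∷ yv 3 ∷ yv 2 ∷ xv 4 ∷ yv 6 ∷ yv 4 ∷ xv 5 ∷ yv 7 ∷ xv 9 ∷ yv 9 ∷ xv 8 ∷ yv 10 ∷ yv 8 ∷ xv 7 ∷ xv 6 ∷ yv 5 ∷ xv 3 ∷ []) ∷ [])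
  ∷ᵥ ((xv 0 ∷ yv 2 ∷ xv 1 ∷ yv 3 ∷ xv 4 ∷ xv 5 ∷ yv 6 ∷ yv 7 ∷ yv 5 ∷ xv 7 ∷ xv 8 ∷ yv 8 ∷ xv 6 ∷ yv 4 ∷ xv 3 ∷ yv 1 ∷ yv 0 ∷ xv 2 ∷ []) ∷ [])
  ∷ᵥ []ᵥ )

[8,2] : AdmDecomp 5 (8 ∷ 2 ∷ []) 𝒳
[8,2] = fromCycles 5 (8 ∷ 2 ∷ []) 𝒳
  ( ((xv 2 ∷ yv 1 ∷ yv 2 ∷ yv 3 ∷ xv 5 ∷ xv 3 ∷ yv 5 ∷ yv 4 ∷ []) ∷ (xv 4 ∷ xv 6 ∷ []) ∷ [])
  ∷ᵥ ((xv 0 ∷ xv 1 ∷ yv 2 ∷ yv 4 ∷ yv 5 ∷ xv 4 ∷ yv 3 ∷ xv 2 ∷ []) ∷ (xv 3 ∷ yv 1 ∷ []) ∷ [])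
  ∷ᵥ ((xv 1 ∷ yv 0 ∷ yv 1 ∷ yv 3 ∷ xv 4 ∷ yv 2 ∷ xv 2 ∷ xv 3 ∷ []) ∷ (xv 5 ∷ yv 4 ∷ []) ∷ [])
  ∷ᵥ ((xv 0 ∷ xv 2 ∷ xv 4 ∷ xv 3 ∷ yv 4 ∷ yv 3 ∷ xv 1 ∷ yv 1 ∷ []) ∷ (yv 0 ∷ yv 2 ∷ []) ∷ [])
  ∷ᵥ ((xv 2 ∷ yv 2 ∷ xv 3 ∷ xv 4 ∷ yv 5 ∷ xv 5 ∷ yv 3 ∷ yv 1 ∷ []) ∷ (xv 6 ∷ yv 4 ∷ []) ∷ [])
  ∷ᵥ ((xv 1 ∷ xv 3 ∷ yv 3 ∷ yv 4 ∷ yv 6 ∷ xv 4 ∷ xv 2 ∷ yv 0 ∷ []) ∷ (xv 0 ∷ yv 2 ∷ []) ∷ [])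
  ∷ᵥ ((xv 1 ∷ yv 3 ∷ yv 5 ∷ xv 3 ∷ xv 2 ∷ yv 4 ∷ yv 2 ∷ yv 1 ∷ []) ∷ (xv 4 ∷ xv 5 ∷ []) ∷ [])
  ∷ᵥ ((xv 3 ∷ xv 5 ∷ yv 5 ∷ yv 3 ∷ yv 2 ∷ xv 4 ∷ yv 6 ∷ yv 4 ∷ []) ∷ (xv 1 ∷ xv 2 ∷ []) ∷ [])
  ∷ᵥ ((xv 0 ∷ yv 1 ∷ yv 0 ∷ xv 2 ∷ yv 3 ∷ xv 3 ∷ yv 2 ∷ xv 1 ∷ []) ∷ (xv 4 ∷ yv 4 ∷ []) ∷ [])
  ∷ᵥ []ᵥ )

[10,2] : InsertableDecomp 6 (10 ∷ 2 ∷ []) 𝒳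
[10,2] = insertableFromCycles 6 (10 ∷ 2 ∷ []) 𝒳
  ( ((xv 2 ∷ yv 2 ∷ xv 4 ∷ yv 6 ∷ xv 5 ∷ xv 7 ∷ yv 5 ∷ xv 3 ∷ yv 3 ∷ yv 1 ∷ []) ∷ (xv 6 ∷ yv 4 ∷ []) ∷ [])
  ∷ᵥ ((xv 0 ∷ yv 2 ∷ yv 3 ∷ yv 4 ∷ xv 5 ∷ yv 6 ∷ yv 5 ∷ xv 4 ∷ xv 3 ∷ yv 1 ∷ []) ∷ (xv 1 ∷ xv 2 ∷ []) ∷ [])
  ∷ᵥ ((xv 2 ∷ yv 1 ∷ xv 3 ∷ yv 4 ∷ yv 5 ∷ xv 6 ∷ xv 5 ∷ xv 4 ∷ yv 3 ∷ yv 2 ∷ []) ∷ (xv 1 ∷ yv 0 ∷ []) ∷ [])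
  ∷ᵥ ((xv 0 ∷ yv 1 ∷ yv 3 ∷ xv 4 ∷ xv 5 ∷ yv 5 ∷ yv 4 ∷ xv 3 ∷ xv 1 ∷ yv 2 ∷ []) ∷ (xv 2 ∷ yv 0 ∷ []) ∷ [])
  ∷ᵥ ((xv 2 ∷ yv 4 ∷ yv 6 ∷ xv 4 ∷ xv 6 ∷ yv 5 ∷ xv 7 ∷ xv 5 ∷ yv 3 ∷ xv 3 ∷ []) ∷ (yv 1 ∷ yv 2 ∷ []) ∷ [])
  ∷ᵥ ((xv 0 ∷ xv 2 ∷ xv 3 ∷ xv 4 ∷ yv 5 ∷ yv 7 ∷ xv 5 ∷ yv 4 ∷ yv 3 ∷ xv 1 ∷ []) ∷ (yv 0 ∷ yv 2 ∷ []) ∷ [])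
  ∷ᵥ ((xv 2 ∷ yv 3 ∷ xv 5 ∷ xv 6 ∷ xv 4 ∷ yv 2 ∷ xv 3 ∷ yv 5 ∷ yv 6 ∷ yv 4 ∷ []) ∷ (xv 1 ∷ yv 1 ∷ []) ∷ [])
  ∷ᵥ ((xv 1 ∷ xv 3 ∷ xv 5 ∷ yv 7 ∷ yv 5 ∷ yv 3 ∷ xv 2 ∷ xv 4 ∷ yv 4 ∷ yv 2 ∷ []) ∷ (xv 6 ∷ yv 6 ∷ []) ∷ [])
  ∷ᵥ ((xv 0 ∷ xv 1 ∷ yv 3 ∷ yv 5 ∷ xv 5 ∷ xv 3 ∷ yv 2 ∷ yv 4 ∷ xv 4 ∷ xv 2 ∷ []) ∷ (yv 0 ∷ yv 1 ∷ []) ∷ [])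
  ∷ᵥ []ᵥ )

[12,2] : InsertableDecomp 7 (12 ∷ 2 ∷ []) 𝒳
[12,2] = insertableFromCycles 7 (12 ∷ 2 ∷ []) 𝒳
  ( ((xv 2 ∷ yv 1 ∷ xv 3 ∷ yv 4 ∷ yv 5 ∷ xv 7 ∷ xv 5 ∷ yv 7 ∷ xv 6 ∷ xv 4 ∷ yv 3 ∷ yv 2 ∷ []) ∷ (xv 8 ∷ yv 6 ∷ []) ∷ [])
  ∷ᵥ ((xv 0 ∷ yv 1 ∷ yv 2 ∷ yv 3 ∷ xv 4 ∷ yv 6 ∷ yv 7 ∷ yv 5 ∷ yv 4 ∷ xv 3 ∷ xv 2 ∷ xv 1 ∷ []) ∷ (xv 5 ∷ xv 6 ∷ []) ∷ [])
  ∷ᵥ ((xv 1 ∷ yv 2 ∷ yv 4 ∷ xv 5 ∷ xv 3 ∷ yv 1 ∷ yv 3 ∷ yv 5 ∷ yv 6 ∷ xv 4 ∷ xv 2 ∷ yv 0 ∷ []) ∷ (xv 6 ∷ xv 7 ∷ []) ∷ [])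
  ∷ᵥ ((xv 1 ∷ yv 1 ∷ yv 0 ∷ yv 2 ∷ xv 4 ∷ xv 6 ∷ yv 4 ∷ yv 6 ∷ xv 5 ∷ yv 5 ∷ xv 3 ∷ yv 3 ∷ []) ∷ (xv 0 ∷ xv 2 ∷ []) ∷ [])
  ∷ᵥ ((xv 2 ∷ yv 2 ∷ xv 3 ∷ xv 4 ∷ xv 5 ∷ xv 7 ∷ yv 5 ∷ yv 7 ∷ yv 6 ∷ yv 4 ∷ yv 3 ∷ yv 1 ∷ []) ∷ (xv 6 ∷ xv 8 ∷ []) ∷ [])
  ∷ᵥ ((xv 1 ∷ yv 0 ∷ xv 2 ∷ yv 3 ∷ yv 4 ∷ xv 6 ∷ yv 8 ∷ yv 6 ∷ yv 5 ∷ xv 5 ∷ xv 4 ∷ xv 3 ∷ []) ∷ (xv 0 ∷ yv 2 ∷ []) ∷ [])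
  ∷ᵥ ((xv 1 ∷ xv 2 ∷ yv 4 ∷ xv 4 ∷ yv 5 ∷ xv 6 ∷ yv 7 ∷ xv 5 ∷ yv 3 ∷ xv 3 ∷ yv 2 ∷ yv 1 ∷ []) ∷ (xv 7 ∷ yv 6 ∷ []) ∷ [])
  ∷ᵥ ((xv 1 ∷ xv 3 ∷ xv 5 ∷ yv 6 ∷ yv 8 ∷ xv 6 ∷ yv 5 ∷ yv 3 ∷ xv 2 ∷ xv 4 ∷ yv 4 ∷ yv 2 ∷ []) ∷ (xv 7 ∷ yv 7 ∷ []) ∷ [])
  ∷ᵥ ((xv 0 ∷ xv 1 ∷ yv 3 ∷ xv 5 ∷ yv 4 ∷ xv 2 ∷ xv 3 ∷ yv 5 ∷ xv 4 ∷ yv 2 ∷ yv 0 ∷ yv 1 ∷ []) ∷ (xv 6 ∷ yv 6 ∷ []) ∷ [])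
  ∷ᵥ []ᵥ )

[14,2] : InsertableDecomp 8 (14 ∷ 2 ∷ []) 𝒳
[14,2] = insertableFromCycles 8 (14 ∷ 2 ∷ []) 𝒳
  ( ((xv 2 ∷ yv 1 ∷ yv 3 ∷ yv 5 ∷ xv 5 ∷ xv 3 ∷ yv 2 ∷ yv 4 ∷ xv 6 ∷ yv 7 ∷ xv 9 ∷ xv 7 ∷ yv 6 ∷ xv 4 ∷ []) ∷ (xv 8 ∷ yv 8 ∷ []) ∷ [])
  ∷ᵥ ((xv 0 ∷ xv 2 ∷ yv 3 ∷ xv 4 ∷ yv 5 ∷ yv 6 ∷ xv 5 ∷ xv 7 ∷ xv 6 ∷ yv 4 ∷ xv 3 ∷ xv 1 ∷ yv 2 ∷ yv 1 ∷ []) ∷ (yv 7 ∷ yv 8 ∷ []) ∷ [])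
  ∷ᵥ ((xv 1 ∷ xv 2 ∷ xv 3 ∷ yv 4 ∷ xv 5 ∷ yv 7 ∷ xv 6 ∷ yv 6 ∷ yv 5 ∷ xv 4 ∷ yv 3 ∷ yv 1 ∷ yv 0 ∷ yv 2 ∷ []) ∷ (xv 7 ∷ xv 8 ∷ []) ∷ [])
  ∷ᵥ ((xv 0 ∷ yv 1 ∷ xv 1 ∷ yv 0 ∷ xv 2 ∷ xv 4 ∷ xv 6 ∷ xv 7 ∷ yv 5 ∷ yv 3 ∷ xv 3 ∷ xv 5 ∷ yv 4 ∷ yv 2 ∷ []) ∷ (yv 6 ∷ yv 7 ∷ []) ∷ [])
  ∷ᵥ ((xv 2 ∷ yv 2 ∷ yv 3 ∷ yv 4 ∷ yv 5 ∷ xv 6 ∷ yv 8 ∷ xv 7 ∷ xv 9 ∷ yv 7 ∷ xv 5 ∷ xv 4 ∷ xv 3 ∷ yv 1 ∷ []) ∷ (xv 8 ∷ yv 6 ∷ []) ∷ [])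
  ∷ᵥ ((xv 0 ∷ yv 2 ∷ xv 4 ∷ yv 4 ∷ yv 6 ∷ xv 7 ∷ yv 9 ∷ yv 7 ∷ yv 5 ∷ xv 3 ∷ yv 3 ∷ xv 2 ∷ yv 0 ∷ xv 1 ∷ []) ∷ (xv 5 ∷ xv 6 ∷ []) ∷ [])
  ∷ᵥ ((xv 1 ∷ yv 1 ∷ yv 2 ∷ xv 3 ∷ xv 2 ∷ yv 4 ∷ xv 4 ∷ yv 6 ∷ yv 8 ∷ xv 6 ∷ yv 5 ∷ xv 7 ∷ xv 5 ∷ yv 3 ∷ []) ∷ (xv 8 ∷ yv 7 ∷ []) ∷ [])
  ∷ᵥ ((xv 1 ∷ xv 3 ∷ xv 4 ∷ xv 5 ∷ yv 5 ∷ yv 7 ∷ yv 9 ∷ xv 7 ∷ yv 8 ∷ yv 6 ∷ yv 4 ∷ yv 3 ∷ yv 2 ∷ xv 2 ∷ []) ∷ (xv 6 ∷ xv 8 ∷ []) ∷ [])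
  ∷ᵥ ((xv 0 ∷ xv 1 ∷ yv 3 ∷ xv 5 ∷ yv 6 ∷ xv 6 ∷ xv 4 ∷ yv 2 ∷ yv 0 ∷ yv 1 ∷ xv 3 ∷ yv 5 ∷ yv 4 ∷ xv 2 ∷ []) ∷ (xv 7 ∷ yv 7 ∷ []) ∷ [])
  ∷ᵥ []ᵥ )

[16,2] : InsertableDecomp 9 (16 ∷ 2 ∷ []) 𝒳
[16,2] = insertableFromCycles 9 (16 ∷ 2 ∷ []) 𝒳
  ( ((xv 2 ∷ xv 3 ∷ yv 5 ∷ xv 7 ∷ xv 6 ∷ yv 8 ∷ xv 9 ∷ yv 9 ∷ yv 7 ∷ yv 6 ∷ xv 4 ∷ yv 2 ∷ yv 1 ∷ yv 3 ∷ xv 5 ∷ yv 4 ∷ []) ∷ (xv 8 ∷ xv 10 ∷ []) ∷ [])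
  ∷ᵥ ((xv 0 ∷ yv 1 ∷ xv 2 ∷ xv 1 ∷ xv 3 ∷ xv 4 ∷ xv 5 ∷ yv 7 ∷ yv 9 ∷ xv 8 ∷ xv 6 ∷ yv 5 ∷ yv 6 ∷ yv 4 ∷ yv 3 ∷ yv 2 ∷ []) ∷ (xv 7 ∷ yv 8 ∷ []) ∷ [])
  ∷ᵥ ((xv 2 ∷ yv 3 ∷ yv 5 ∷ xv 6 ∷ xv 7 ∷ yv 7 ∷ xv 8 ∷ xv 9 ∷ yv 8 ∷ yv 6 ∷ xv 5 ∷ xv 3 ∷ yv 1 ∷ yv 2 ∷ yv 4 ∷ xv 4 ∷ []) ∷ (xv 1 ∷ yv 0 ∷ []) ∷ [])
  ∷ᵥ ((xv 1 ∷ yv 1 ∷ yv 0 ∷ yv 2 ∷ yv 3 ∷ yv 4 ∷ yv 5 ∷ yv 7 ∷ xv 5 ∷ xv 7 ∷ xv 8 ∷ yv 6 ∷ yv 8 ∷ xv 6 ∷ xv 4 ∷ xv 3 ∷ []) ∷ (xv 0 ∷ xv 2 ∷ []) ∷ [])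
  ∷ᵥ ((xv 2 ∷ xv 4 ∷ yv 5 ∷ yv 3 ∷ yv 1 ∷ xv 3 ∷ xv 5 ∷ yv 6 ∷ xv 7 ∷ yv 9 ∷ xv 9 ∷ xv 8 ∷ yv 7 ∷ xv 6 ∷ yv 4 ∷ yv 2 ∷ []) ∷ (xv 10 ∷ yv 8 ∷ []) ∷ [])
  ∷ᵥ ((xv 2 ∷ yv 4 ∷ yv 6 ∷ yv 7 ∷ yv 8 ∷ yv 10 ∷ xv 8 ∷ xv 7 ∷ yv 5 ∷ xv 4 ∷ xv 6 ∷ xv 5 ∷ yv 3 ∷ xv 3 ∷ yv 2 ∷ yv 0 ∷ []) ∷ (xv 0 ∷ xv 1 ∷ []) ∷ [])
  ∷ᵥ ((xv 1 ∷ yv 2 ∷ xv 3 ∷ yv 4 ∷ xv 6 ∷ yv 6 ∷ xv 8 ∷ yv 9 ∷ yv 8 ∷ yv 7 ∷ yv 5 ∷ xv 5 ∷ xv 4 ∷ yv 3 ∷ xv 2 ∷ yv 1 ∷ []) ∷ (xv 7 ∷ xv 9 ∷ []) ∷ [])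
  ∷ᵥ ((xv 1 ∷ xv 2 ∷ yv 2 ∷ xv 4 ∷ yv 4 ∷ xv 5 ∷ xv 6 ∷ xv 8 ∷ yv 10 ∷ yv 8 ∷ yv 9 ∷ xv 7 ∷ yv 6 ∷ yv 5 ∷ xv 3 ∷ yv 3 ∷ []) ∷ (xv 9 ∷ yv 7 ∷ []) ∷ [])
  ∷ᵥ ((xv 0 ∷ yv 2 ∷ xv 1 ∷ yv 3 ∷ xv 4 ∷ yv 6 ∷ xv 6 ∷ yv 7 ∷ xv 7 ∷ xv 5 ∷ yv 5 ∷ yv 4 ∷ xv 3 ∷ xv 2 ∷ yv 0 ∷ yv 1 ∷ []) ∷ (xv 8 ∷ yv 8 ∷ []) ∷ [])
  ∷ᵥ []ᵥ )

[8,2,2] : AdmDecomp 6 (8 ∷ 2 ∷ 2 ∷ []) 𝒳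
[8,2,2] = fromCycles 6 (8 ∷ 2 ∷ 2 ∷ []) 𝒳
  ( ((xv 2 ∷ yv 1 ∷ yv 2 ∷ xv 3 ∷ xv 4 ∷ yv 6 ∷ xv 5 ∷ yv 3 ∷ []) ∷ (xv 6 ∷ yv 4 ∷ []) ∷ (xv 7 ∷ yv 5 ∷ []) ∷ [])
  ∷ᵥ ((xv 2 ∷ yv 3 ∷ xv 3 ∷ xv 5 ∷ yv 6 ∷ yv 4 ∷ yv 2 ∷ yv 1 ∷ []) ∷ (xv 0 ∷ xv 1 ∷ []) ∷ (xv 4 ∷ yv 5 ∷ []) ∷ [])
  ∷ᵥ ((xv 3 ∷ yv 3 ∷ yv 1 ∷ yv 0 ∷ yv 2 ∷ xv 4 ∷ xv 6 ∷ yv 5 ∷ []) ∷ (xv 1 ∷ xv 2 ∷ []) ∷ (xv 5 ∷ yv 4 ∷ []) ∷ [])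
  ∷ᵥ ((xv 1 ∷ yv 0 ∷ yv 1 ∷ yv 3 ∷ xv 4 ∷ xv 5 ∷ xv 3 ∷ yv 2 ∷ []) ∷ (xv 0 ∷ xv 2 ∷ []) ∷ (yv 4 ∷ yv 5 ∷ []) ∷ [])
  ∷ᵥ ((xv 2 ∷ yv 4 ∷ yv 6 ∷ yv 5 ∷ xv 6 ∷ xv 4 ∷ yv 3 ∷ yv 2 ∷ []) ∷ (xv 3 ∷ yv 1 ∷ []) ∷ (xv 5 ∷ xv 7 ∷ []) ∷ [])
  ∷ᵥ ((xv 1 ∷ xv 3 ∷ yv 5 ∷ yv 3 ∷ yv 4 ∷ xv 4 ∷ xv 2 ∷ yv 0 ∷ []) ∷ (xv 0 ∷ yv 2 ∷ []) ∷ (xv 5 ∷ yv 7 ∷ []) ∷ [])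
  ∷ᵥ ((xv 2 ∷ yv 2 ∷ yv 3 ∷ yv 5 ∷ yv 6 ∷ xv 4 ∷ yv 4 ∷ xv 3 ∷ []) ∷ (xv 1 ∷ yv 1 ∷ []) ∷ (xv 5 ∷ xv 6 ∷ []) ∷ [])
  ∷ᵥ ((xv 1 ∷ yv 3 ∷ xv 5 ∷ xv 4 ∷ yv 2 ∷ yv 4 ∷ xv 2 ∷ xv 3 ∷ []) ∷ (xv 6 ∷ yv 6 ∷ []) ∷ (yv 5 ∷ yv 7 ∷ []) ∷ [])
  ∷ᵥ ((xv 1 ∷ yv 2 ∷ yv 0 ∷ xv 2 ∷ xv 4 ∷ xv 3 ∷ yv 4 ∷ yv 3 ∷ []) ∷ (xv 0 ∷ yv 1 ∷ []) ∷ (xv 5 ∷ yv 5 ∷ []) ∷ [])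
  ∷ᵥ []ᵥ )

[10,2,2] : InsertableDecomp 7 (10 ∷ 2 ∷ 2 ∷ []) 𝒳
[10,2,2] = insertableFromCycles 7 (10 ∷ 2 ∷ 2 ∷ []) 𝒳
  ( ((xv 2 ∷ yv 1 ∷ xv 3 ∷ xv 4 ∷ xv 5 ∷ yv 7 ∷ yv 5 ∷ yv 4 ∷ yv 3 ∷ yv 2 ∷ []) ∷ (xv 6 ∷ xv 8 ∷ []) ∷ (xv 7 ∷ yv 6 ∷ []) ∷ [])
  ∷ᵥ ((xv 0 ∷ yv 2 ∷ yv 1 ∷ xv 1 ∷ yv 3 ∷ yv 4 ∷ xv 5 ∷ xv 4 ∷ xv 3 ∷ xv 2 ∷ []) ∷ (xv 6 ∷ yv 7 ∷ []) ∷ (yv 5 ∷ yv 6 ∷ []) ∷ [])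
  ∷ᵥ ((xv 3 ∷ yv 3 ∷ yv 1 ∷ yv 0 ∷ yv 2 ∷ xv 4 ∷ yv 4 ∷ yv 6 ∷ xv 5 ∷ yv 5 ∷ []) ∷ (xv 1 ∷ xv 2 ∷ []) ∷ (xv 6 ∷ xv 7 ∷ []) ∷ [])
  ∷ᵥ ((xv 2 ∷ xv 3 ∷ yv 5 ∷ xv 4 ∷ yv 2 ∷ yv 0 ∷ yv 1 ∷ yv 3 ∷ xv 5 ∷ yv 4 ∷ []) ∷ (xv 0 ∷ xv 1 ∷ []) ∷ (xv 6 ∷ yv 6 ∷ []) ∷ [])
  ∷ᵥ ((xv 2 ∷ yv 3 ∷ yv 5 ∷ xv 6 ∷ xv 5 ∷ xv 3 ∷ yv 1 ∷ yv 2 ∷ yv 4 ∷ xv 4 ∷ []) ∷ (xv 7 ∷ yv 7 ∷ []) ∷ (xv 8 ∷ yv 6 ∷ []) ∷ [])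
  ∷ᵥ ((xv 0 ∷ xv 2 ∷ xv 4 ∷ yv 5 ∷ yv 3 ∷ xv 3 ∷ xv 5 ∷ xv 6 ∷ yv 4 ∷ yv 2 ∷ []) ∷ (xv 1 ∷ yv 0 ∷ []) ∷ (yv 6 ∷ yv 8 ∷ []) ∷ [])
  ∷ᵥ ((xv 1 ∷ yv 1 ∷ xv 2 ∷ yv 4 ∷ xv 6 ∷ xv 4 ∷ yv 6 ∷ yv 7 ∷ xv 5 ∷ yv 3 ∷ []) ∷ (xv 3 ∷ yv 2 ∷ []) ∷ (xv 7 ∷ yv 5 ∷ []) ∷ [])
  ∷ᵥ ((xv 1 ∷ xv 3 ∷ yv 4 ∷ yv 5 ∷ yv 7 ∷ yv 6 ∷ xv 4 ∷ yv 3 ∷ xv 2 ∷ yv 2 ∷ []) ∷ (xv 5 ∷ xv 7 ∷ []) ∷ (xv 6 ∷ yv 8 ∷ []) ∷ [])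
  ∷ᵥ ((xv 1 ∷ yv 2 ∷ yv 3 ∷ xv 4 ∷ xv 6 ∷ yv 5 ∷ xv 5 ∷ yv 6 ∷ yv 4 ∷ xv 3 ∷ []) ∷ (xv 0 ∷ yv 1 ∷ []) ∷ (xv 2 ∷ yv 0 ∷ []) ∷ [])
  ∷ᵥ []ᵥ )

[12,2,2] : InsertableDecomp 8 (12 ∷ 2 ∷ 2 ∷ []) 𝒳
[12,2,2] = insertableFromCycles 8 (12 ∷ 2 ∷ 2 ∷ []) 𝒳
  ( ((xv 2 ∷ yv 1 ∷ yv 3 ∷ yv 4 ∷ yv 5 ∷ xv 7 ∷ xv 8 ∷ xv 6 ∷ xv 5 ∷ xv 4 ∷ xv 3 ∷ yv 2 ∷ []) ∷ (xv 9 ∷ yv 7 ∷ []) ∷ (yv 6 ∷ yv 8 ∷ []) ∷ [])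
  ∷ᵥ ((xv 1 ∷ xv 2 ∷ yv 4 ∷ xv 4 ∷ xv 6 ∷ yv 6 ∷ yv 7 ∷ yv 5 ∷ xv 5 ∷ yv 3 ∷ yv 1 ∷ xv 3 ∷ []) ∷ (xv 0 ∷ yv 2 ∷ []) ∷ (xv 7 ∷ yv 8 ∷ []) ∷ [])
  ∷ᵥ ((xv 1 ∷ yv 1 ∷ yv 0 ∷ xv 2 ∷ yv 2 ∷ xv 4 ∷ yv 4 ∷ yv 6 ∷ xv 6 ∷ yv 5 ∷ xv 3 ∷ yv 3 ∷ []) ∷ (xv 5 ∷ xv 7 ∷ []) ∷ (xv 8 ∷ yv 7 ∷ []) ∷ [])
  ∷ᵥ ((xv 0 ∷ xv 1 ∷ yv 2 ∷ xv 3 ∷ yv 4 ∷ xv 5 ∷ yv 5 ∷ xv 4 ∷ yv 3 ∷ xv 2 ∷ yv 0 ∷ yv 1 ∷ []) ∷ (xv 6 ∷ yv 7 ∷ []) ∷ (xv 7 ∷ yv 6 ∷ []) ∷ [])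
  ∷ᵥ ((xv 2 ∷ yv 3 ∷ yv 5 ∷ yv 7 ∷ yv 6 ∷ xv 5 ∷ xv 3 ∷ yv 1 ∷ yv 2 ∷ yv 4 ∷ xv 6 ∷ xv 4 ∷ []) ∷ (xv 7 ∷ xv 9 ∷ []) ∷ (xv 8 ∷ yv 8 ∷ []) ∷ [])
  ∷ᵥ ((xv 0 ∷ xv 2 ∷ xv 4 ∷ yv 5 ∷ yv 3 ∷ xv 3 ∷ xv 5 ∷ yv 6 ∷ yv 4 ∷ yv 2 ∷ yv 0 ∷ xv 1 ∷ []) ∷ (xv 6 ∷ xv 7 ∷ []) ∷ (yv 7 ∷ yv 9 ∷ []) ∷ [])
  ∷ᵥ ((xv 1 ∷ xv 3 ∷ xv 4 ∷ yv 6 ∷ xv 8 ∷ xv 7 ∷ yv 5 ∷ yv 4 ∷ yv 3 ∷ yv 2 ∷ yv 1 ∷ xv 2 ∷ []) ∷ (xv 5 ∷ yv 7 ∷ []) ∷ (xv 6 ∷ yv 8 ∷ []) ∷ [])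
  ∷ᵥ ((xv 1 ∷ yv 3 ∷ xv 5 ∷ yv 4 ∷ xv 2 ∷ xv 3 ∷ yv 5 ∷ xv 6 ∷ xv 8 ∷ yv 6 ∷ xv 4 ∷ yv 2 ∷ []) ∷ (xv 7 ∷ yv 9 ∷ []) ∷ (yv 7 ∷ yv 8 ∷ []) ∷ [])
  ∷ᵥ ((xv 0 ∷ yv 1 ∷ xv 1 ∷ yv 0 ∷ yv 2 ∷ yv 3 ∷ xv 4 ∷ xv 5 ∷ xv 6 ∷ yv 4 ∷ xv 3 ∷ xv 2 ∷ []) ∷ (xv 7 ∷ yv 7 ∷ []) ∷ (yv 5 ∷ yv 6 ∷ []) ∷ [])
  ∷ᵥ []ᵥ )

[14,2,2] : InsertableDecomp 9 (14 ∷ 2 ∷ 2 ∷ []) 𝒳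
[14,2,2] = insertableFromCycles 9 (14 ∷ 2 ∷ 2 ∷ []) 𝒳
  ( ((xv 2 ∷ yv 2 ∷ yv 1 ∷ yv 3 ∷ yv 4 ∷ xv 5 ∷ yv 5 ∷ xv 7 ∷ yv 9 ∷ yv 7 ∷ yv 6 ∷ xv 6 ∷ xv 4 ∷ xv 3 ∷ []) ∷ (xv 8 ∷ xv 9 ∷ []) ∷ (xv 10 ∷ yv 8 ∷ []) ∷ [])
  ∷ᵥ ((xv 0 ∷ xv 2 ∷ xv 1 ∷ yv 3 ∷ yv 2 ∷ xv 4 ∷ xv 5 ∷ xv 7 ∷ yv 7 ∷ xv 6 ∷ yv 4 ∷ yv 5 ∷ xv 3 ∷ yv 1 ∷ []) ∷ (xv 8 ∷ yv 6 ∷ []) ∷ (yv 8 ∷ yv 9 ∷ []) ∷ [])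
  ∷ᵥ ((xv 1 ∷ yv 1 ∷ xv 2 ∷ yv 0 ∷ yv 2 ∷ yv 3 ∷ xv 4 ∷ xv 6 ∷ yv 8 ∷ xv 8 ∷ yv 7 ∷ yv 5 ∷ yv 4 ∷ xv 3 ∷ []) ∷ (xv 5 ∷ yv 6 ∷ []) ∷ (xv 7 ∷ xv 9 ∷ []) ∷ [])
  ∷ᵥ ((xv 0 ∷ yv 2 ∷ xv 3 ∷ yv 4 ∷ xv 6 ∷ xv 8 ∷ yv 8 ∷ xv 7 ∷ yv 5 ∷ yv 6 ∷ xv 4 ∷ yv 3 ∷ xv 1 ∷ xv 2 ∷ []) ∷ (xv 5 ∷ yv 7 ∷ []) ∷ (yv 0 ∷ yv 1 ∷ []) ∷ [])
  ∷ᵥ ((xv 2 ∷ yv 1 ∷ yv 2 ∷ yv 4 ∷ yv 6 ∷ yv 7 ∷ yv 9 ∷ xv 7 ∷ xv 6 ∷ xv 5 ∷ xv 3 ∷ yv 3 ∷ yv 5 ∷ xv 4 ∷ []) ∷ (xv 8 ∷ xv 10 ∷ []) ∷ (xv 9 ∷ yv 8 ∷ []) ∷ [])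
  ∷ᵥ ((xv 2 ∷ yv 4 ∷ xv 4 ∷ yv 5 ∷ xv 6 ∷ yv 6 ∷ yv 8 ∷ yv 7 ∷ xv 7 ∷ xv 5 ∷ yv 3 ∷ xv 3 ∷ yv 2 ∷ yv 0 ∷ []) ∷ (xv 0 ∷ xv 1 ∷ []) ∷ (xv 8 ∷ yv 10 ∷ []) ∷ [])
  ∷ᵥ ((xv 1 ∷ yv 2 ∷ xv 2 ∷ xv 3 ∷ xv 4 ∷ yv 6 ∷ xv 7 ∷ yv 8 ∷ xv 6 ∷ yv 5 ∷ xv 5 ∷ yv 4 ∷ yv 3 ∷ yv 1 ∷ []) ∷ (xv 8 ∷ yv 9 ∷ []) ∷ (xv 9 ∷ yv 7 ∷ []) ∷ [])
  ∷ᵥ ((xv 1 ∷ xv 3 ∷ yv 5 ∷ yv 7 ∷ xv 8 ∷ xv 6 ∷ xv 7 ∷ yv 6 ∷ yv 4 ∷ xv 2 ∷ yv 3 ∷ xv 5 ∷ xv 4 ∷ yv 2 ∷ []) ∷ (xv 9 ∷ yv 9 ∷ []) ∷ (yv 8 ∷ yv 10 ∷ []) ∷ [])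
  ∷ᵥ ((xv 0 ∷ yv 1 ∷ xv 3 ∷ xv 5 ∷ xv 6 ∷ yv 7 ∷ yv 8 ∷ yv 6 ∷ yv 5 ∷ yv 3 ∷ xv 2 ∷ xv 4 ∷ yv 4 ∷ yv 2 ∷ []) ∷ (xv 1 ∷ yv 0 ∷ []) ∷ (xv 7 ∷ xv 8 ∷ []) ∷ [])
  ∷ᵥ []ᵥ )

[16,2,2] : InsertableDecomp 10 (16 ∷ 2 ∷ 2 ∷ []) 𝒳
[16,2,2] = insertableFromCycles 10 (16 ∷ 2 ∷ 2 ∷ []) 𝒳
  ( ((xv 2 ∷ yv 3 ∷ yv 5 ∷ xv 7 ∷ xv 5 ∷ xv 3 ∷ yv 1 ∷ yv 2 ∷ yv 4 ∷ yv 6 ∷ yv 8 ∷ xv 9 ∷ xv 8 ∷ yv 7 ∷ xv 6 ∷ xv 4 ∷ []) ∷ (xv 10 ∷ yv 10 ∷ []) ∷ (xv 11 ∷ yv 9 ∷ []) ∷ [])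
  ∷ᵥ ((xv 0 ∷ yv 2 ∷ yv 3 ∷ xv 4 ∷ xv 5 ∷ yv 5 ∷ yv 7 ∷ yv 9 ∷ yv 8 ∷ xv 8 ∷ xv 7 ∷ yv 6 ∷ xv 6 ∷ yv 4 ∷ xv 3 ∷ xv 1 ∷ []) ∷ (xv 2 ∷ yv 1 ∷ []) ∷ (xv 9 ∷ yv 10 ∷ []) ∷ [])
  ∷ᵥ ((xv 3 ∷ yv 4 ∷ yv 5 ∷ xv 5 ∷ yv 7 ∷ xv 9 ∷ xv 10 ∷ xv 8 ∷ yv 8 ∷ xv 6 ∷ yv 6 ∷ xv 4 ∷ yv 3 ∷ yv 2 ∷ yv 0 ∷ yv 1 ∷ []) ∷ (xv 1 ∷ xv 2 ∷ []) ∷ (xv 7 ∷ yv 9 ∷ []) ∷ [])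
  ∷ᵥ ((xv 0 ∷ xv 1 ∷ yv 1 ∷ yv 0 ∷ xv 2 ∷ xv 4 ∷ yv 6 ∷ xv 7 ∷ xv 8 ∷ xv 6 ∷ yv 5 ∷ yv 3 ∷ xv 3 ∷ xv 5 ∷ yv 4 ∷ yv 2 ∷ []) ∷ (xv 9 ∷ yv 9 ∷ []) ∷ (yv 7 ∷ yv 8 ∷ []) ∷ [])
  ∷ᵥ ((xv 2 ∷ yv 2 ∷ yv 1 ∷ yv 3 ∷ yv 4 ∷ xv 5 ∷ xv 6 ∷ xv 8 ∷ yv 10 ∷ yv 8 ∷ xv 7 ∷ yv 7 ∷ yv 6 ∷ yv 5 ∷ xv 4 ∷ xv 3 ∷ []) ∷ (xv 9 ∷ xv 11 ∷ []) ∷ (xv 10 ∷ yv 9 ∷ []) ∷ [])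
  ∷ᵥ ((xv 1 ∷ yv 0 ∷ yv 2 ∷ xv 4 ∷ yv 4 ∷ xv 6 ∷ yv 8 ∷ yv 9 ∷ yv 11 ∷ xv 9 ∷ yv 7 ∷ xv 5 ∷ xv 7 ∷ yv 5 ∷ xv 3 ∷ yv 3 ∷ []) ∷ (xv 0 ∷ xv 2 ∷ []) ∷ (xv 8 ∷ yv 6 ∷ []) ∷ [])
  ∷ᵥ ((xv 1 ∷ xv 3 ∷ yv 2 ∷ xv 2 ∷ yv 4 ∷ xv 4 ∷ yv 5 ∷ yv 6 ∷ yv 7 ∷ xv 8 ∷ xv 9 ∷ xv 7 ∷ xv 6 ∷ xv 5 ∷ yv 3 ∷ yv 1 ∷ []) ∷ (xv 10 ∷ yv 8 ∷ []) ∷ (yv 9 ∷ yv 10 ∷ []) ∷ [])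
  ∷ᵥ ((xv 2 ∷ xv 3 ∷ xv 4 ∷ xv 6 ∷ xv 7 ∷ yv 8 ∷ yv 10 ∷ xv 8 ∷ xv 10 ∷ xv 9 ∷ yv 11 ∷ yv 9 ∷ yv 7 ∷ yv 5 ∷ yv 4 ∷ yv 3 ∷ []) ∷ (xv 1 ∷ yv 2 ∷ []) ∷ (xv 5 ∷ yv 6 ∷ []) ∷ [])
  ∷ᵥ ((xv 1 ∷ yv 3 ∷ xv 5 ∷ xv 4 ∷ yv 2 ∷ xv 3 ∷ yv 5 ∷ xv 6 ∷ yv 7 ∷ xv 7 ∷ xv 9 ∷ yv 8 ∷ yv 6 ∷ yv 4 ∷ xv 2 ∷ yv 0 ∷ []) ∷ (xv 0 ∷ yv 1 ∷ []) ∷ (xv 8 ∷ yv 9 ∷ []) ∷ [])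
  ∷ᵥ []ᵥ )

[10,4] : AdmDecomp 7 (10 ∷ 4 ∷ []) 𝒳
[10,4] = fromCycles 7 (10 ∷ 4 ∷ []) 𝒳
  ( ((xv 4 ∷ yv 4 ∷ yv 3 ∷ xv 5 ∷ yv 5 ∷ yv 7 ∷ xv 7 ∷ xv 6 ∷ xv 8 ∷ yv 6 ∷ []) ∷ (xv 2 ∷ xv 3 ∷ yv 2 ∷ yv 1 ∷ []) ∷ [])
  ∷ᵥ ((xv 0 ∷ yv 2 ∷ xv 1 ∷ xv 3 ∷ yv 1 ∷ yv 3 ∷ xv 4 ∷ xv 6 ∷ yv 4 ∷ xv 2 ∷ []) ∷ (xv 5 ∷ yv 6 ∷ yv 7 ∷ yv 5 ∷ []) ∷ [])
  ∷ᵥ ((xv 3 ∷ xv 5 ∷ xv 7 ∷ yv 6 ∷ xv 6 ∷ yv 5 ∷ xv 4 ∷ yv 3 ∷ yv 4 ∷ yv 2 ∷ []) ∷ (xv 1 ∷ yv 1 ∷ yv 0 ∷ xv 2 ∷ []) ∷ [])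
  ∷ᵥ ((xv 0 ∷ yv 1 ∷ xv 3 ∷ yv 5 ∷ yv 3 ∷ xv 2 ∷ xv 4 ∷ yv 2 ∷ yv 0 ∷ xv 1 ∷ []) ∷ (xv 5 ∷ xv 6 ∷ yv 6 ∷ yv 4 ∷ []) ∷ [])
  ∷ᵥ ((xv 2 ∷ yv 1 ∷ yv 2 ∷ yv 3 ∷ yv 5 ∷ xv 7 ∷ xv 5 ∷ yv 4 ∷ xv 3 ∷ xv 4 ∷ []) ∷ (xv 6 ∷ yv 7 ∷ yv 6 ∷ xv 8 ∷ []) ∷ [])
  ∷ᵥ ((xv 2 ∷ yv 4 ∷ xv 4 ∷ yv 5 ∷ xv 6 ∷ yv 8 ∷ yv 6 ∷ xv 5 ∷ yv 3 ∷ xv 3 ∷ []) ∷ (xv 0 ∷ xv 1 ∷ yv 0 ∷ yv 2 ∷ []) ∷ [])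
  ∷ᵥ ((xv 1 ∷ xv 2 ∷ yv 2 ∷ yv 4 ∷ yv 6 ∷ xv 7 ∷ yv 5 ∷ xv 3 ∷ yv 3 ∷ yv 1 ∷ []) ∷ (xv 4 ∷ xv 5 ∷ yv 7 ∷ xv 6 ∷ []) ∷ [])
  ∷ᵥ ((xv 3 ∷ yv 4 ∷ yv 5 ∷ yv 6 ∷ yv 8 ∷ xv 6 ∷ xv 7 ∷ yv 7 ∷ xv 5 ∷ xv 4 ∷ []) ∷ (xv 1 ∷ yv 2 ∷ xv 2 ∷ yv 3 ∷ []) ∷ [])
  ∷ᵥ ((xv 1 ∷ yv 3 ∷ yv 2 ∷ xv 4 ∷ yv 6 ∷ yv 5 ∷ yv 4 ∷ xv 6 ∷ xv 5 ∷ xv 3 ∷ []) ∷ (xv 0 ∷ xv 2 ∷ yv 0 ∷ yv 1 ∷ []) ∷ [])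
  ∷ᵥ []ᵥ )

[12,4] : InsertableDecomp 8 (12 ∷ 4 ∷ []) 𝒳
[12,4] = insertableFromCycles 8 (12 ∷ 4 ∷ []) 𝒳
  ( ((xv 2 ∷ xv 3 ∷ xv 4 ∷ yv 6 ∷ xv 8 ∷ yv 8 ∷ xv 6 ∷ yv 5 ∷ yv 4 ∷ yv 3 ∷ yv 2 ∷ yv 1 ∷ []) ∷ (xv 5 ∷ xv 7 ∷ xv 9 ∷ yv 7 ∷ []) ∷ [])
  ∷ᵥ ((xv 0 ∷ yv 2 ∷ xv 1 ∷ yv 1 ∷ xv 3 ∷ yv 4 ∷ xv 6 ∷ xv 5 ∷ yv 5 ∷ xv 4 ∷ yv 3 ∷ xv 2 ∷ []) ∷ (xv 7 ∷ yv 7 ∷ yv 6 ∷ yv 8 ∷ []) ∷ [])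
  ∷ᵥ ((xv 1 ∷ yv 0 ∷ yv 1 ∷ yv 2 ∷ yv 3 ∷ xv 4 ∷ xv 6 ∷ yv 6 ∷ xv 5 ∷ yv 4 ∷ xv 3 ∷ xv 2 ∷ []) ∷ (xv 7 ∷ xv 8 ∷ yv 7 ∷ yv 5 ∷ []) ∷ [])
  ∷ᵥ ((xv 0 ∷ xv 1 ∷ xv 3 ∷ yv 2 ∷ yv 0 ∷ xv 2 ∷ yv 4 ∷ yv 6 ∷ xv 4 ∷ xv 5 ∷ yv 3 ∷ yv 1 ∷ []) ∷ (xv 6 ∷ xv 7 ∷ yv 5 ∷ yv 7 ∷ []) ∷ [])
  ∷ᵥ ((xv 2 ∷ yv 1 ∷ yv 3 ∷ xv 5 ∷ xv 4 ∷ yv 2 ∷ xv 3 ∷ yv 5 ∷ xv 6 ∷ xv 8 ∷ yv 6 ∷ yv 4 ∷ []) ∷ (xv 7 ∷ yv 8 ∷ yv 7 ∷ xv 9 ∷ []) ∷ [])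
  ∷ᵥ ((xv 1 ∷ yv 3 ∷ yv 4 ∷ yv 5 ∷ xv 5 ∷ yv 6 ∷ yv 7 ∷ yv 9 ∷ xv 7 ∷ xv 6 ∷ xv 4 ∷ xv 3 ∷ []) ∷ (xv 0 ∷ xv 2 ∷ yv 0 ∷ yv 2 ∷ []) ∷ [])
  ∷ᵥ ((xv 1 ∷ yv 2 ∷ yv 4 ∷ xv 4 ∷ xv 2 ∷ yv 3 ∷ yv 5 ∷ yv 6 ∷ xv 7 ∷ xv 5 ∷ xv 3 ∷ yv 1 ∷ []) ∷ (xv 6 ∷ yv 7 ∷ yv 8 ∷ xv 8 ∷ []) ∷ [])
  ∷ᵥ ((xv 1 ∷ xv 2 ∷ yv 2 ∷ xv 4 ∷ yv 4 ∷ xv 5 ∷ xv 6 ∷ yv 8 ∷ yv 6 ∷ yv 5 ∷ xv 3 ∷ yv 3 ∷ []) ∷ (xv 7 ∷ yv 9 ∷ yv 7 ∷ xv 8 ∷ []) ∷ [])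
  ∷ᵥ ((xv 2 ∷ xv 4 ∷ yv 5 ∷ yv 3 ∷ xv 3 ∷ xv 5 ∷ yv 7 ∷ xv 7 ∷ yv 6 ∷ xv 6 ∷ yv 4 ∷ yv 2 ∷ []) ∷ (xv 0 ∷ yv 1 ∷ yv 0 ∷ xv 1 ∷ []) ∷ [])
  ∷ᵥ []ᵥ )

[14,4] : InsertableDecomp 9 (14 ∷ 4 ∷ []) 𝒳
[14,4] = insertableFromCycles 9 (14 ∷ 4 ∷ []) 𝒳
  ( ((xv 2 ∷ yv 2 ∷ xv 4 ∷ yv 4 ∷ xv 5 ∷ xv 7 ∷ yv 9 ∷ yv 7 ∷ xv 6 ∷ yv 6 ∷ yv 5 ∷ xv 3 ∷ yv 1 ∷ yv 3 ∷ []) ∷ (xv 8 ∷ xv 10 ∷ yv 8 ∷ xv 9 ∷ []) ∷ [])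
  ∷ᵥ ((xv 2 ∷ yv 4 ∷ xv 4 ∷ xv 6 ∷ yv 7 ∷ yv 6 ∷ yv 8 ∷ yv 9 ∷ xv 8 ∷ xv 7 ∷ yv 5 ∷ xv 5 ∷ yv 3 ∷ yv 1 ∷ []) ∷ (xv 0 ∷ yv 2 ∷ xv 3 ∷ xv 1 ∷ []) ∷ [])
  ∷ᵥ ((xv 1 ∷ yv 3 ∷ yv 4 ∷ xv 6 ∷ xv 7 ∷ yv 6 ∷ xv 5 ∷ yv 5 ∷ xv 4 ∷ xv 3 ∷ yv 2 ∷ yv 0 ∷ xv 2 ∷ yv 1 ∷ []) ∷ (xv 8 ∷ yv 7 ∷ xv 9 ∷ yv 8 ∷ []) ∷ [])
  ∷ᵥ ((xv 1 ∷ xv 3 ∷ yv 4 ∷ yv 5 ∷ yv 7 ∷ xv 7 ∷ yv 8 ∷ yv 6 ∷ xv 8 ∷ xv 6 ∷ xv 5 ∷ xv 4 ∷ yv 3 ∷ yv 2 ∷ []) ∷ (xv 0 ∷ xv 2 ∷ yv 0 ∷ yv 1 ∷ []) ∷ [])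
  ∷ᵥ ((xv 2 ∷ yv 3 ∷ xv 5 ∷ xv 6 ∷ yv 8 ∷ xv 10 ∷ xv 8 ∷ yv 6 ∷ xv 4 ∷ yv 2 ∷ yv 1 ∷ xv 3 ∷ yv 5 ∷ yv 4 ∷ []) ∷ (xv 7 ∷ yv 7 ∷ yv 9 ∷ xv 9 ∷ []) ∷ [])
  ∷ᵥ ((xv 0 ∷ xv 1 ∷ yv 0 ∷ yv 2 ∷ yv 4 ∷ yv 6 ∷ xv 7 ∷ xv 5 ∷ xv 3 ∷ yv 3 ∷ yv 5 ∷ xv 6 ∷ xv 4 ∷ xv 2 ∷ []) ∷ (xv 8 ∷ yv 10 ∷ yv 8 ∷ yv 7 ∷ []) ∷ [])
  ∷ᵥ ((xv 1 ∷ yv 1 ∷ yv 2 ∷ xv 2 ∷ xv 3 ∷ xv 4 ∷ xv 5 ∷ yv 7 ∷ yv 8 ∷ xv 6 ∷ yv 5 ∷ yv 6 ∷ yv 4 ∷ yv 3 ∷ []) ∷ (xv 7 ∷ xv 8 ∷ xv 9 ∷ yv 9 ∷ []) ∷ [])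
  ∷ᵥ ((xv 1 ∷ yv 2 ∷ yv 3 ∷ xv 4 ∷ yv 5 ∷ xv 7 ∷ xv 9 ∷ yv 7 ∷ xv 5 ∷ yv 6 ∷ xv 6 ∷ yv 4 ∷ xv 3 ∷ xv 2 ∷ []) ∷ (xv 8 ∷ yv 9 ∷ yv 8 ∷ yv 10 ∷ []) ∷ [])
  ∷ᵥ ((xv 0 ∷ yv 1 ∷ yv 0 ∷ xv 1 ∷ xv 2 ∷ xv 4 ∷ yv 6 ∷ yv 7 ∷ yv 5 ∷ yv 3 ∷ xv 3 ∷ xv 5 ∷ yv 4 ∷ yv 2 ∷ []) ∷ (xv 6 ∷ xv 8 ∷ yv 8 ∷ xv 7 ∷ []) ∷ [])
  ∷ᵥ []ᵥ )

[16,4] : InsertableDecomp 10 (16 ∷ 4 ∷ []) 𝒳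
[16,4] = insertableFromCycles 10 (16 ∷ 4 ∷ []) 𝒳
  ( ((xv 2 ∷ yv 4 ∷ yv 5 ∷ xv 7 ∷ yv 6 ∷ xv 4 ∷ xv 6 ∷ yv 8 ∷ xv 10 ∷ xv 8 ∷ yv 7 ∷ xv 5 ∷ yv 3 ∷ yv 2 ∷ yv 1 ∷ xv 3 ∷ []) ∷ (xv 9 ∷ yv 10 ∷ yv 9 ∷ xv 11 ∷ []) ∷ [])
  ∷ᵥ ((xv 0 ∷ xv 1 ∷ yv 2 ∷ xv 2 ∷ yv 3 ∷ yv 4 ∷ yv 6 ∷ xv 6 ∷ xv 8 ∷ yv 8 ∷ xv 7 ∷ yv 5 ∷ xv 5 ∷ xv 4 ∷ xv 3 ∷ yv 1 ∷ []) ∷ (xv 9 ∷ yv 7 ∷ yv 9 ∷ yv 10 ∷ []) ∷ [])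
  ∷ᵥ ((xv 1 ∷ yv 0 ∷ yv 1 ∷ yv 3 ∷ yv 5 ∷ yv 6 ∷ yv 7 ∷ xv 8 ∷ xv 7 ∷ xv 6 ∷ xv 5 ∷ xv 3 ∷ yv 2 ∷ yv 4 ∷ xv 4 ∷ xv 2 ∷ []) ∷ (xv 9 ∷ xv 10 ∷ yv 8 ∷ yv 9 ∷ []) ∷ [])
  ∷ᵥ ((xv 0 ∷ yv 1 ∷ yv 0 ∷ xv 1 ∷ yv 3 ∷ xv 5 ∷ yv 7 ∷ yv 8 ∷ yv 6 ∷ yv 4 ∷ xv 2 ∷ xv 3 ∷ yv 5 ∷ xv 6 ∷ xv 4 ∷ yv 2 ∷ []) ∷ (xv 7 ∷ xv 9 ∷ xv 8 ∷ yv 9 ∷ []) ∷ [])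
  ∷ᵥ ((xv 2 ∷ yv 1 ∷ yv 2 ∷ xv 3 ∷ xv 4 ∷ yv 5 ∷ yv 7 ∷ xv 7 ∷ yv 8 ∷ yv 10 ∷ xv 8 ∷ yv 6 ∷ xv 5 ∷ xv 6 ∷ yv 4 ∷ yv 3 ∷ []) ∷ (xv 9 ∷ xv 11 ∷ yv 9 ∷ xv 10 ∷ []) ∷ [])
  ∷ᵥ ((xv 1 ∷ xv 3 ∷ yv 4 ∷ xv 5 ∷ yv 6 ∷ xv 8 ∷ xv 6 ∷ xv 7 ∷ yv 9 ∷ yv 11 ∷ xv 9 ∷ yv 8 ∷ yv 7 ∷ yv 5 ∷ xv 4 ∷ yv 3 ∷ []) ∷ (xv 0 ∷ yv 2 ∷ yv 0 ∷ xv 2 ∷ []) ∷ [])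
  ∷ᵥ ((xv 1 ∷ yv 1 ∷ xv 2 ∷ xv 4 ∷ yv 6 ∷ yv 8 ∷ xv 9 ∷ xv 7 ∷ yv 7 ∷ xv 6 ∷ yv 5 ∷ yv 3 ∷ xv 3 ∷ xv 5 ∷ yv 4 ∷ yv 2 ∷ []) ∷ (xv 8 ∷ yv 10 ∷ xv 10 ∷ yv 9 ∷ []) ∷ [])
  ∷ᵥ ((xv 1 ∷ xv 2 ∷ yv 2 ∷ yv 3 ∷ xv 4 ∷ xv 5 ∷ xv 7 ∷ xv 8 ∷ xv 10 ∷ yv 10 ∷ yv 8 ∷ xv 6 ∷ yv 6 ∷ yv 5 ∷ yv 4 ∷ xv 3 ∷ []) ∷ (xv 9 ∷ yv 11 ∷ yv 9 ∷ yv 7 ∷ []) ∷ [])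
  ∷ᵥ ((xv 0 ∷ xv 2 ∷ yv 0 ∷ yv 2 ∷ xv 4 ∷ yv 4 ∷ xv 6 ∷ yv 7 ∷ yv 6 ∷ xv 7 ∷ xv 5 ∷ yv 5 ∷ xv 3 ∷ yv 3 ∷ yv 1 ∷ xv 1 ∷ []) ∷ (xv 8 ∷ xv 9 ∷ yv 9 ∷ yv 8 ∷ []) ∷ [])
  ∷ᵥ []ᵥ )

[18,4] : InsertableDecomp 11 (18 ∷ 4 ∷ []) 𝒳
[18,4] = insertableFromCycles 11 (18 ∷ 4 ∷ []) 𝒳
  ( ((xv 2 ∷ xv 4 ∷ yv 6 ∷ yv 7 ∷ xv 9 ∷ xv 11 ∷ yv 11 ∷ yv 9 ∷ xv 8 ∷ xv 7 ∷ xv 6 ∷ yv 4 ∷ yv 2 ∷ xv 3 ∷ xv 5 ∷ yv 5 ∷ yv 3 ∷ yv 1 ∷ []) ∷ (xv 10 ∷ yv 8 ∷ yv 10 ∷ xv 12 ∷ []) ∷ [])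
  ∷ᵥ ((xv 0 ∷ xv 2 ∷ yv 3 ∷ yv 2 ∷ xv 4 ∷ yv 4 ∷ xv 5 ∷ yv 6 ∷ xv 7 ∷ xv 8 ∷ xv 10 ∷ yv 9 ∷ yv 7 ∷ xv 6 ∷ yv 5 ∷ xv 3 ∷ xv 1 ∷ yv 1 ∷ []) ∷ (xv 9 ∷ yv 11 ∷ yv 10 ∷ yv 8 ∷ []) ∷ [])
  ∷ᵥ ((xv 3 ∷ yv 1 ∷ yv 3 ∷ xv 4 ∷ yv 5 ∷ xv 7 ∷ xv 5 ∷ xv 6 ∷ yv 7 ∷ xv 8 ∷ xv 9 ∷ xv 10 ∷ xv 11 ∷ yv 10 ∷ yv 9 ∷ yv 8 ∷ yv 6 ∷ yv 4 ∷ []) ∷ (xv 1 ∷ yv 0 ∷ yv 2 ∷ xv 2 ∷ []) ∷ [])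
  ∷ᵥ ((xv 0 ∷ xv 1 ∷ yv 3 ∷ xv 5 ∷ yv 4 ∷ xv 2 ∷ yv 0 ∷ yv 1 ∷ xv 3 ∷ yv 5 ∷ xv 6 ∷ xv 7 ∷ yv 7 ∷ yv 8 ∷ xv 8 ∷ yv 6 ∷ xv 4 ∷ yv 2 ∷ []) ∷ (xv 9 ∷ yv 9 ∷ yv 10 ∷ xv 10 ∷ []) ∷ [])
  ∷ᵥ ((xv 2 ∷ yv 1 ∷ yv 2 ∷ yv 3 ∷ yv 4 ∷ yv 5 ∷ yv 6 ∷ xv 5 ∷ xv 7 ∷ yv 8 ∷ yv 7 ∷ yv 9 ∷ yv 11 ∷ xv 9 ∷ xv 8 ∷ xv 6 ∷ xv 4 ∷ xv 3 ∷ []) ∷ (xv 10 ∷ xv 12 ∷ yv 10 ∷ xv 11 ∷ []) ∷ [])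
  ∷ᵥ ((xv 0 ∷ yv 2 ∷ yv 0 ∷ xv 2 ∷ xv 3 ∷ yv 4 ∷ yv 6 ∷ yv 5 ∷ yv 7 ∷ xv 7 ∷ yv 9 ∷ xv 9 ∷ yv 8 ∷ xv 6 ∷ xv 5 ∷ xv 4 ∷ yv 3 ∷ xv 1 ∷ []) ∷ (xv 8 ∷ yv 10 ∷ yv 12 ∷ xv 10 ∷ []) ∷ [])
  ∷ᵥ ((xv 1 ∷ xv 2 ∷ yv 4 ∷ xv 4 ∷ xv 6 ∷ yv 6 ∷ yv 8 ∷ xv 7 ∷ xv 9 ∷ yv 10 ∷ xv 8 ∷ yv 7 ∷ yv 5 ∷ xv 5 ∷ yv 3 ∷ xv 3 ∷ yv 2 ∷ yv 1 ∷ []) ∷ (xv 10 ∷ yv 11 ∷ xv 11 ∷ yv 9 ∷ []) ∷ [])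
  ∷ᵥ ((xv 1 ∷ xv 3 ∷ xv 4 ∷ xv 5 ∷ yv 7 ∷ yv 6 ∷ xv 6 ∷ xv 8 ∷ yv 8 ∷ yv 9 ∷ xv 11 ∷ xv 9 ∷ xv 7 ∷ yv 5 ∷ yv 4 ∷ yv 3 ∷ xv 2 ∷ yv 2 ∷ []) ∷ (xv 10 ∷ yv 12 ∷ yv 10 ∷ yv 11 ∷ []) ∷ [])
  ∷ᵥ ((xv 0 ∷ yv 1 ∷ yv 0 ∷ xv 1 ∷ yv 2 ∷ yv 4 ∷ xv 6 ∷ yv 8 ∷ xv 10 ∷ yv 10 ∷ xv 9 ∷ yv 7 ∷ xv 5 ∷ xv 3 ∷ yv 3 ∷ yv 5 ∷ xv 4 ∷ xv 2 ∷ []) ∷ (xv 7 ∷ yv 6 ∷ xv 8 ∷ yv 9 ∷ []) ∷ [])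
  ∷ᵥ []ᵥ )

-- The four families

LongCycleDecomp : ℕ → List ℕ → ℕ → Set
LongCycleDecomp δ rest s = AdmDecomp (s + δ) (2 * s ∷ rest) 𝒳

InsertableLongCycleDecomp : ℕ → List ℕ → ℕ → Set
InsertableLongCycleDecomp δ rest s = InsertableDecomp (s + δ) (2 * s ∷ rest) 𝒳

insertColumns-longCycle : ∀ {δ rest s} → 6 ≤ s + δ →
  InsertableLongCycleDecomp δ rest s → InsertableLongCycleDecomp δ rest (4 + s)
insertColumns-longCycle {δ} {rest} {s} 6≤ D =
  subst (λ ℓ → InsertableDecomp (4 + s + δ) (ℓ ∷ rest) 𝒳) 2s+8≡2[4+s] (insertColumns-decomp {P = 𝒳} 6≤ D)
  where
  2s+8≡2[4+s] : 2 * s + 8 ≡ 2 * (4 + s)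
  2s+8≡2[4+s] = trans (ℕ.+-comm (2 * s) 8) (sym (ℕ.*-distribˡ-+ 2 4 s))

longCycleDecomps-from : ∀ {δ rest} s₀ {_ : True (6 ℕ.≤? s₀ + δ)} →
  InsertableLongCycleDecomp δ rest s₀ → InsertableLongCycleDecomp δ rest (1 + s₀) →
  InsertableLongCycleDecomp δ rest (2 + s₀) → InsertableLongCycleDecomp δ rest (3 + s₀) →
  ∀ s → s₀ ≤ s → InsertableLongCycleDecomp δ rest s
longCycleDecomps-from {δ} {rest} s₀ {6≤} D₀ D₁ D₂ D₃ s s₀≤s
  with n , refl ← ℕ.m≤n⇒∃[o]m+o≡n s₀≤s =
  subst (InsertableLongCycleDecomp δ rest) (ℕ.+-comm n s₀) (go n)
  where
  go : ∀ n → InsertableLongCycleDecomp δ rest (n + s₀)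
  go 0 = D₀
  go 1 = D₁
  go 2 = D₂
  go 3 = D₃
  go (suc (suc (suc (suc n)))) =
    insertColumns-longCycle (ℕ.≤-trans (toWitness 6≤) (ℕ.+-monoˡ-≤ δ (ℕ.m≤n+m s₀ n))) (go n)

from-base : ∀ {P : ℕ → Set} {s₀} → P s₀ → (∀ s → suc s₀ ≤ s → P s) → ∀ s → s₀ ≤ s → P s
from-base P₀ P> s s₀≤s with ℕ.m≤n⇒m<n∨m≡n s₀≤s
... | inj₁ s₀<s = P> s s₀<s
... | inj₂ refl = P₀

from-order : ∀ {δ rest s₀} → sum rest ≡ 2 * δ → (∀ s → s₀ ≤ s → LongCycleDecomp δ rest s) →
  ∀ m s → s₀ ≤ s → sum (2 * s ∷ rest) ≡ 2 * m → AdmDecomp m (2 * s ∷ rest) 𝒳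
from-order {δ} {rest} rest≡ D m s s₀≤s order≡ =
  subst (λ m → AdmDecomp m (2 * s ∷ rest) 𝒳) s+δ≡m (D s s₀≤s)
  where
  s+δ≡m : s + δ ≡ m
  s+δ≡m = ℕ.*-cancelˡ-≡ (s + δ) m 2 (begin
    2 * (s + δ)        ≡⟨ ℕ.*-distribˡ-+ 2 s δ ⟩
    2 * s + 2 * δ      ≡⟨ cong (2 * s +_) (sym rest≡) ⟩
    2 * s + sum rest   ≡⟨ order≡ ⟩
    2 * m              ∎)
    where open ≡-Reasoning

decomp-[2s] : ∀ s → 4 ≤ s → LongCycleDecomp 0 [] s
decomp-[2s] = from-base {LongCycleDecomp 0 []} [8] (from-base {LongCycleDecomp 0 []} [10] λ s 6≤s →
  proj₁ (longCycleDecomps-from 6 [12] [14] [16] [18] s 6≤s))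

decomp-[2s,2] : ∀ s → 4 ≤ s → LongCycleDecomp 1 (2 ∷ []) s
decomp-[2s,2] = from-base {LongCycleDecomp 1 (2 ∷ [])} [8,2] λ s 5≤s →
  proj₁ (longCycleDecomps-from 5 [10,2] [12,2] [14,2] [16,2] s 5≤s)

decomp-[2s,2,2] : ∀ s → 4 ≤ s → LongCycleDecomp 2 (2 ∷ 2 ∷ []) s
decomp-[2s,2,2] = from-base {LongCycleDecomp 2 (2 ∷ 2 ∷ [])} [8,2,2] λ s 5≤s →
  proj₁ (longCycleDecomps-from 5 [10,2,2] [12,2,2] [14,2,2] [16,2,2] s 5≤s)

decomp-[2s,4] : ∀ s → 5 ≤ s → LongCycleDecomp 2 (4 ∷ []) s
decomp-[2s,4] = from-base {LongCycleDecomp 2 (4 ∷ [])} [10,4] λ s 6≤s →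
  proj₁ (longCycleDecomps-from 6 [12,4] [14,4] [16,4] [18,4] s 6≤s)

lemma4p19 : (∀ m s → 4 ≤ s → sum (2 * s ∷ []) ≡ 2 * m → AdmDecomp m (2 * s ∷ []) 𝒳)
      × (∀ m s → 4 ≤ s → sum (2 * s ∷ 2 ∷ []) ≡ 2 * m → AdmDecomp m (2 * s ∷ 2 ∷ []) 𝒳)
      × (∀ m s → 4 ≤ s → sum (2 * s ∷ 2 ∷ 2 ∷ []) ≡ 2 * m → AdmDecomp m (2 * s ∷ 2 ∷ 2 ∷ []) 𝒳)
      × (∀ m s → 5 ≤ s → sum (2 * s ∷ 4 ∷ []) ≡ 2 * m → AdmDecomp m (2 * s ∷ 4 ∷ []) 𝒳)
lemma4p19 =
  from-order refl decomp-[2s] , from-order refl decomp-[2s,2] ,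
  from-order refl decomp-[2s,2,2] , from-order refl decomp-[2s,4]
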